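{- Let $K=\mathbb{Q}(\sqrt{d})$, let $p>3$ be a prime, and let $A,B,C$ be pairwise coprime $p$th-power-free integers. Let $(x,y,z)\in K^3$ be a nontrivial solution of $Ax^p+By^p+Cz^p=0$ whose associated point $(X,Y)$ on $Y^2=X^p+\frac{A^2(BC)^{p-1}}{4}$ satisfies $Y\in\mathbb{Q}$. Then there exists a primitive solution in $\mathbb{Z}$ of $Ax^p+By^p+Cz^p=0$.
   Context: $d$ is a squarefree integer with $d\neq 0,1$. A nontrivial solution in $K$ is a triple $(x,y,z)\in K^3$ satisfying $Ax^p+By^p+Cz^p=0$ with $xyz\neq 0$; a primitive solution in $\mathbb{Z}$ is a nontrivial solution $(x,y,z)\in\mathbb{Z}^3$ with $x,y,z$ pairwise coprime. An integer is $p$th-power-free if it is not divisible by $q^p$ for any prime $q$. The point associated to $(x,y,z)$ is $(X,Y)$ with $X=\frac{ -BCyz}{x^2}$ and $Y=\frac{(-BC)^{\frac{p-1}{2}}(By^p-Cz^p)}{2x^p}$; it lies on $Y^2=X^p+\frac{A^2(BC)^{p-1}}{4}$. -}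

module Defs where

open import Data.Nat as ℕ using (ℕ; zero; suc)
open import Data.Nat.Divisibility using (_∣_)
open import Data.Nat.Primality using (Prime)
open import Data.Integer as ℤ using (ℤ; ∣_∣)
open import Data.Integer.Coprimality as ℤC using ()
open import Data.Rational as ℚ using (ℚ; 0ℚ; 1ℚ)
open import Data.Product using (_×_; _,_; Σ; ∃-syntax)
open import Relation.Binary.PropositionalEquality using (_≡_; _≢_)
open import Relation.Nullary using (¬_; yes; no)

Squarefree : ℤ → Set
Squarefree d = ∀ (n : ℕ) → (n ℕ.* n) ∣ ∣ d ∣ → n ≡ 1

PthPowerFree : ℕ → ℤ → Set
PthPowerFree p a = ∀ (q : ℕ) → Prime q → ¬ ((q ℕ.^ p) ∣ ∣ a ∣)

ι : ℤ → ℚ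
ι n = n ℚ./ 1

-- Elements of K = ℚ(√d): a + b√d  represented as the pair (a , b).
-- Since d is squarefree and d ≠ 0,1, √d ∉ ℚ and this representation is unique.
record QF (d : ℤ) : Set where
  constructor _+√_
  field
    re : ℚ
    im : ℚ
open QF public

module _ {d : ℤ} where
  embed : ℚ → QF d
  embed a = a +√ 0ℚ

  0K : QF d
  0K = embed 0ℚ

  1K : QF d
  1K = embed 1ℚ

  _+K_ : QF d → QF d → QF d
  (a +√ b) +K (c +√ e) = (a ℚ.+ c) +√ (b ℚ.+ e)

  _-K_ : QF d → QF d → QF d
  (a +√ b) -K (c +√ e) = (a ℚ.- c) +√ (b ℚ.- e)

  _*K_ : QF d → QF d → QF d
  (a +√ b) *K (c +√ e) = ((a ℚ.* c) ℚ.+ ((ι d ℚ.* b) ℚ.* e)) +√ ((a ℚ.* e) ℚ.+ (b ℚ.* c))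

  _^K_ : QF d → ℕ → QF d
  x ^K zero = 1K
  x ^K suc n = x *K (x ^K n)

  normK : QF d → ℚ
  normK (a +√ b) = (a ℚ.* a) ℚ.- ((ι d ℚ.* b) ℚ.* b)

  -- inverse (a - b√d)/(a² - d b²); for x = 0 we return 0 (junk value, never used
  -- on x ≠ 0 since the norm is nonzero for nonzero x when d is not a square)
  invK : QF d → QF d
  invK (a +√ b) with normK (a +√ b) ℚ.≟ 0ℚ
  ... | yes _ = 0K
  ... | no n≢0 = (a ℚ.* r) +√ (ℚ.- (b ℚ.* r))
    where
      r : ℚ
      r = ℚ.1/_ (normK (a +√ b)) {{ℚ.≢-nonZero n≢0}}

  _/K_ : QF d → QF d → QF d
  x /K y = x *K invK y

  ιK : ℤ → QF d
  ιK n = embed (ι n)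

NontrivialSolK : (d : ℤ) → ℕ → ℤ → ℤ → ℤ → QF d → QF d → QF d → Set
NontrivialSolK d p A B C x y z =
  ((ιK A *K (x ^K p)) +K ((ιK B *K (y ^K p)) +K (ιK C *K (z ^K p)))) ≡ 0K
  × ((x *K y) *K z) ≢ 0K

assocY : (d : ℤ) → ℕ → ℤ → ℤ → ℤ → QF d → QF d → QF d → QF d
assocY d p A B C x y z =
  (ιK ((ℤ.- (B ℤ.* C)) ℤ.^ ((p ℕ.∸ 1) ℕ./ 2)) *K ((ιK B *K (y ^K p)) -K (ιK C *K (z ^K p))))
    /K (ιK (ℤ.+ 2) *K (x ^K p))

assocX : (d : ℤ) → ℤ → ℤ → QF d → QF d → QF d → QF d
assocX d B C x y z = (ιK (ℤ.- (B ℤ.* C)) *K (y *K z)) /K (x *K x)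

InQ : {d : ℤ} → QF d → Set
InQ x = im x ≡ 0ℚ

PrimitiveSolZ : ℕ → ℤ → ℤ → ℤ → ℤ → ℤ → ℤ → Set
PrimitiveSolZ p A B C x y z =
  ((A ℤ.* (x ℤ.^ p)) ℤ.+ ((B ℤ.* (y ℤ.^ p)) ℤ.+ (C ℤ.* (z ℤ.^ p)))) ≡ ℤ.0ℤ
  × ((x ℤ.* y) ℤ.* z) ≢ ℤ.0ℤ
  × ℤC.Coprime x y × ℤC.Coprime y z × ℤC.Coprime x z

HasPrimitiveSolZ : ℕ → ℤ → ℤ → ℤ → Set
HasPrimitiveSolZ p A B C = ∃[ x ] ∃[ y ] ∃[ z ] PrimitiveSolZ p A B C x y z

{-# OPTIONS --safe #-}

-- Dividing by x turns the solution into the point (1, v, u) with v = y/x and u = z/x in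
-- K = ℚ(√d). Clearing the denominator of Y = k(Byᵖ − Czᵖ)/(2xᵖ), k = (−BC)^((p−1)/2) ≠ 0,
-- and comparing with the equation A + Bvᵖ + Cuᵖ = 0 shows that the √d-parts of Bvᵖ and Cuᵖ
-- vanish, so vᵖ and uᵖ are rational. For p ≥ 5 with p² ∤ d, an element of K whose p-th
-- power is rational is itself rational: after scaling it is a + b√d with a, b ∈ ℤ not both
-- divisible by p, and if b ≠ 0 the √d-part Σⱼ C(p,2j+1) a^(p−2j−1) b^(2j+1) dʲ of (a + b√d)ᵖ
-- cannot vanish — reading it modulo p, p²b and p^((p+1)/2) gives p ∣ db², then p ∣ a, then
-- p² ∣ d. Hence v, u are nonzero rationals with A + Bvᵖ + Cuᵖ = 0; clearing denominators
-- gives an integer solution, and a prime dividing two coordinates divides the third (A, B, C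
-- are p-th-power-free), so dividing it out repeatedly yields a primitive solution.

module Submission where

open import Algebra.Bundles using (CommutativeRing; Monoid; Ring)
open import Algebra.Structures using (IsCommutativeRing)
import Algebra.Properties.Monoid.Sum as Sum
open import Data.Empty using (⊥-elim)
open import Data.Fin using (Fin; zero; suc; toℕ; fromℕ<)
import Data.Fin.Properties as Fin
open import Data.Integer as ℤ using (ℤ; +_; 0ℤ; 1ℤ)
import Data.Integer.Coprimality as ℤC
open import Data.Integer.Coprimality using (Coprime)
open import Data.Integer.Divisibility.Signed as ℤ∣ using (divides; ∣ᵤ⇒∣; ∣⇒∣ᵤ)
import Data.Integer.Properties as ℤ
open import Data.Integer.Tactic.RingSolver using () renaming (solve-∀ to solve-∀ℤ)
open import Data.List.Base using (_∷_; [])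
open import Data.List.Relation.Unary.All using (_∷_)
open import Data.Maybe.Base using (Maybe; just; nothing)
open import Data.Nat as ℕ using (ℕ; zero; suc; _>_)
import Data.Nat.Combinatorics as ℕ
import Data.Nat.Coprimality as ℕC
open import Data.Nat.Divisibility as ℕ using (divides; ∣-refl; ∣-reflexive; ∣1⇒≡1; ∣⇒≤)
open import Data.Nat.DivMod using (_/_; m/n*n≡m)
open import Data.Nat.GCD using (gcd; gcd[m,n]∣m; gcd[m,n]∣n; gcd[m,n]≢0)
open import Data.Nat.Induction using (<-wellFounded)
open import Data.Nat.Primality
  using (Prime; euclidsLemma; ¬prime[0]; ¬prime[1]; prime[2]; prime⇒nonZero; prime⇒nonTrivial; prime⇒irreducible)
open import Data.Nat.Primality.Factorisation using (PrimeFactorisation; factorise)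
import Data.Nat.Properties as ℕ
import Data.Nat.Tactic.RingSolver as ℕSolver
open import Data.Product using (_×_; _,_; Σ-syntax; proj₁; proj₂)
open import Data.Rational as ℚ using (ℚ; 0ℚ; 1ℚ; ↥_; ↧_; mkℚ)
import Data.Rational.Properties as ℚ
open import Data.Rational.Unnormalised using (mkℚᵘ; *≡*)
import Data.Sign.Properties as Sign
open import Data.Sum using (_⊎_; inj₁; inj₂; [_,_]′)
open import Function using (id; _∘_)
open import Induction.WellFounded using (Acc; acc)
open import Level using (0ℓ)
open import Relation.Binary.PropositionalEquality
open import Relation.Nullary using (¬_; yes; no)
open import Relation.Nullary.Decidable using (_×-dec_)
open import Relation.Nullary.Negation using (contradiction)
import Tactic.RingSolver.Core.AlmostCommutativeRing as ACR
open import Tactic.RingSolver using (solve-∀)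

open import Algebra.Properties.CommutativeSemiring.Exp
  (CommutativeRing.commutativeSemiring ℚ.+-*-commutativeRing) using (_^_; ^-distrib-*)
open import Algebra.Properties.Group ℚ.+-0-group using () renaming (x∙y⁻¹≈ε⇒x≈y to p-q≡0⇒p≡q)

open import Defs

-- Arithmetic in ℕ and ℤ

∣0 : ∀ i → i ℤ∣.∣ 0ℤ
∣0 i = divides 0ℤ (sym (ℤ.*-zeroˡ i))

1∣ : ∀ i → 1ℤ ℤ∣.∣ i
1∣ i = divides i (sym (ℤ.*-identityʳ i))

^-distribʳ-* : ∀ i j n → (i ℤ.* j) ℤ.^ n ≡ i ℤ.^ n ℤ.* j ℤ.^ n
^-distribʳ-* i j zero    = refl
^-distribʳ-* i j (suc n) = trans (cong ((i ℤ.* j) ℤ.*_) (^-distribʳ-* i j n)) (interchange i j (i ℤ.^ n) (j ℤ.^ n))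
  where
  interchange : ∀ i j x y → i ℤ.* j ℤ.* (x ℤ.* y) ≡ i ℤ.* x ℤ.* (j ℤ.* y)
  interchange = solve-∀ℤ

*-pres-∣ : ∀ {i j m n} → i ℤ∣.∣ m → j ℤ∣.∣ n → i ℤ.* j ℤ∣.∣ m ℤ.* n
*-pres-∣ {i} {j} (divides q refl) (divides r refl) = divides (q ℤ.* r) (interchange q i r j)
  where
  interchange : ∀ q i r j → q ℤ.* i ℤ.* (r ℤ.* j) ≡ q ℤ.* r ℤ.* (i ℤ.* j)
  interchange = solve-∀ℤ

^-pres-∣ : ∀ {i m} n → i ℤ∣.∣ m → i ℤ.^ n ℤ∣.∣ m ℤ.^ n
^-pres-∣ zero    _   = ℤ∣.∣-refl
^-pres-∣ (suc n) i∣m = *-pres-∣ i∣m (^-pres-∣ n i∣m)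

*-≢0ℤ : ∀ {i j} → i ≢ 0ℤ → j ≢ 0ℤ → i ℤ.* j ≢ 0ℤ
*-≢0ℤ {i} i≢0 j≢0 ij≡0 = [ i≢0 , j≢0 ]′ (ℤ.i*j≡0⇒i≡0∨j≡0 i ij≡0)

sum-homo : ∀ (M N : Monoid 0ℓ 0ℓ) (h : Monoid.Carrier M → Monoid.Carrier N) →
           h (Monoid.ε M) ≡ Monoid.ε N → (∀ x y → h (Monoid._∙_ M x y) ≡ Monoid._∙_ N (h x) (h y)) →
           ∀ {n} (f : Fin n → Monoid.Carrier M) → h (Sum.sum M f) ≡ Sum.sum N (h ∘ f)
sum-homo M N h h-ε h-∙ {zero}  f = h-ε
sum-homo M N h h-ε h-∙ {suc n} f =
  trans (h-∙ (f zero) _) (cong (Monoid._∙_ N (h (f zero))) (sum-homo M N h h-ε h-∙ (f ∘ suc)))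

∑ℤ : ∀ {n} → (Fin n → ℤ) → ℤ
∑ℤ = Sum.sum ℤ.+-0-monoid

∣-∑ℤ : ∀ {k n} (f : Fin n → ℤ) → (∀ i → k ℤ∣.∣ f i) → k ℤ∣.∣ ∑ℤ f
∣-∑ℤ {k} {zero}  f k∣f = ∣0 k
∣-∑ℤ {k} {suc n} f k∣f = ℤ∣.∣m∣n⇒∣m+n (k∣f zero) (∣-∑ℤ (f ∘ suc) (k∣f ∘ suc))

∣-∑ℤ-except : ∀ {k n} (f : Fin n → ℤ) i →
              (∀ j → j ≢ i → k ℤ∣.∣ f j) → k ℤ∣.∣ ∑ℤ f → k ℤ∣.∣ f i
∣-∑ℤ-except f zero    k∣f k∣∑ = ℤ∣.∣m+n∣n⇒∣m k∣∑ (∣-∑ℤ (f ∘ suc) (λ j → k∣f (suc j) (λ ())))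
∣-∑ℤ-except f (suc i) k∣f k∣∑ = ∣-∑ℤ-except (f ∘ suc) i (λ j j≢i → k∣f (suc j) (j≢i ∘ Fin.suc-injective))
  (ℤ∣.∣m+n∣m⇒∣n k∣∑ (k∣f zero (λ ())))

prime∤! : ∀ {p j} → Prime p → j ℕ.< p → ¬ (p ℕ.∣ j ℕ.!)
prime∤! {j = zero}  p-prime _   p∣1    = ¬prime[1] (subst Prime (∣1⇒≡1 p∣1) p-prime)
prime∤! {j = suc j} p-prime j<p p∣j! with euclidsLemma (suc j) (j ℕ.!) p-prime p∣j!
... | inj₁ p∣1+j = ℕ.<⇒≱ j<p (∣⇒≤ p∣1+j)
... | inj₂ p∣j!  = prime∤! p-prime (ℕ.<-trans (ℕ.n<1+n j) j<p) p∣j!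

n∣n! : ∀ {n} → .{{ℕ.NonZero n}} → n ℕ.∣ n ℕ.!
n∣n! {suc n} = ℕ.m∣m*n (n ℕ.!)

prime∣pCk : ∀ {p k} → Prime p → 0 ℕ.< k → k ℕ.< p → p ℕ.∣ p ℕ.C k
prime∣pCk {p} {k} p-prime 0<k k<p
  with euclidsLemma (p ℕ.C k) (k ℕ.! ℕ.* (p ℕ.∸ k) ℕ.!) p-prime (subst (p ℕ.∣_) (sym pCk*k!*[p-k]!≡p!) p∣p!)
  where
  instance _ = k ℕ.!* (p ℕ.∸ k) !≢0
  pCk*k!*[p-k]!≡p! : (p ℕ.C k) ℕ.* (k ℕ.! ℕ.* (p ℕ.∸ k) ℕ.!) ≡ p ℕ.!
  pCk*k!*[p-k]!≡p! = trans (cong (ℕ._* (k ℕ.! ℕ.* (p ℕ.∸ k) ℕ.!)) (ℕ.nCk≡n!/k![n-k]! (ℕ.<⇒≤ k<p)))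
                           (m/n*n≡m (ℕ.k![n∸k]!∣n! (ℕ.<⇒≤ k<p)))
  p∣p! : p ℕ.∣ p ℕ.!
  p∣p! = n∣n! {{prime⇒nonZero p-prime}}
... | inj₁ p∣pCk = p∣pCk
... | inj₂ p∣k!*[p-k]! with euclidsLemma (k ℕ.!) ((p ℕ.∸ k) ℕ.!) p-prime p∣k!*[p-k]!
...   | inj₁ p∣k!     = contradiction p∣k! (prime∤! p-prime k<p)
...   | inj₂ p∣[p-k]! = contradiction p∣[p-k]! (prime∤! p-prime (ℕ.∸-monoʳ-< 0<k (ℕ.<⇒≤ k<p)))

module _ {p : ℕ} (p-prime : Prime p) where

  euclidsLemmaℤ : ∀ i j → + p ℤ∣.∣ i ℤ.* j → + p ℤ∣.∣ i ⊎ + p ℤ∣.∣ j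
  euclidsLemmaℤ i j p∣ij
    with euclidsLemma ℤ.∣ i ∣ ℤ.∣ j ∣ p-prime (subst (p ℕ.∣_) (ℤ.abs-* i j) (∣⇒∣ᵤ p∣ij))
  ... | inj₁ p∣i = inj₁ (∣ᵤ⇒∣ p∣i)
  ... | inj₂ p∣j = inj₂ (∣ᵤ⇒∣ p∣j)

  prime∣i^n⇒prime∣i : ∀ {i} n → + p ℤ∣.∣ i ℤ.^ n → + p ℤ∣.∣ i
  prime∣i^n⇒prime∣i zero    p∣1 = contradiction (subst Prime (∣1⇒≡1 (∣⇒∣ᵤ p∣1)) p-prime) ¬prime[1]
  prime∣i^n⇒prime∣i (suc n) p∣iⁿ⁺¹ = [ id , prime∣i^n⇒prime∣i n ]′ (euclidsLemmaℤ _ _ p∣iⁿ⁺¹)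

  pᵏ≢0 : ∀ k → (+ p) ℤ.^ k ≢ 0ℤ
  pᵏ≢0 k pᵏ≡0 = ¬prime[0] (subst Prime (ℤ.+-injective (ℤ.i^n≡0⇒i≡0 (+ p) k pᵏ≡0)) p-prime)

  prime^k∣i*j⇒prime^k∣i : ∀ {i j} → ¬ + p ℤ∣.∣ j →
                          ∀ k → (+ p) ℤ.^ k ℤ∣.∣ i ℤ.* j → (+ p) ℤ.^ k ℤ∣.∣ i
  prime^k∣i*j⇒prime^k∣i {i} {j} p∤j zero    _ = 1∣ i
  prime^k∣i*j⇒prime^k∣i {i} {j} p∤j (suc k) pᵏ⁺¹∣ij
    with prime^k∣i*j⇒prime^k∣i {i} {j} p∤j k (ℤ∣.∣-trans (ℤ∣.∣n⇒∣m*n (+ p) ℤ∣.∣-refl) pᵏ⁺¹∣ij)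
  ... | divides c refl = *-pres-∣ ([ id , (λ p∣j → contradiction p∣j p∤j) ]′ (euclidsLemmaℤ c j p∣cj)) ℤ∣.∣-refl
    where
    instance _ = ℤ.≢-nonZero (pᵏ≢0 k)
    rearrange : ∀ c pᵏ j → c ℤ.* pᵏ ℤ.* j ≡ pᵏ ℤ.* (c ℤ.* j)
    rearrange = solve-∀ℤ
    p∣cj : + p ℤ∣.∣ c ℤ.* j
    p∣cj = ℤ∣.*-cancelˡ-∣ ((+ p) ℤ.^ k)
      (subst₂ ℤ∣._∣_ (ℤ.*-comm (+ p) ((+ p) ℤ.^ k)) (rearrange c ((+ p) ℤ.^ k) j) pᵏ⁺¹∣ij)

  ∣+p^n∣≡p^n : ∀ n → ℤ.∣ (+ p) ℤ.^ n ∣ ≡ p ℕ.^ n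
  ∣+p^n∣≡p^n zero    = refl
  ∣+p^n∣≡p^n (suc n) = trans (ℤ.abs-* (+ p) ((+ p) ℤ.^ n)) (cong (p ℕ.*_) (∣+p^n∣≡p^n n))

  prime∣i : ∀ {n c i} → PthPowerFree n c → (+ p) ℤ.^ n ℤ∣.∣ c ℤ.* i ℤ.^ n → + p ℤ∣.∣ i
  prime∣i {n} {c} {i} c-free pⁿ∣ciⁿ with + p ℤ∣.∣? i
  ... | yes p∣i = p∣i
  ... | no p∤i  = contradiction (subst (ℕ._∣ ℤ.∣ c ∣) (∣+p^n∣≡p^n n) (∣⇒∣ᵤ pⁿ∣c)) (c-free p p-prime)
    where
    pⁿ∣c : (+ p) ℤ.^ n ℤ∣.∣ c
    pⁿ∣c = prime^k∣i*j⇒prime^k∣i (p∤i ∘ prime∣i^n⇒prime∣i n) n pⁿ∣ciⁿ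

¬coprime⇒common-prime : ∀ {i j} → i ≢ 0ℤ → ¬ ℤC.Coprime i j →
                        Σ[ q ∈ ℕ ] Prime q × + q ℤ∣.∣ i × + q ℤ∣.∣ j
¬coprime⇒common-prime {i} {j} i≢0 ¬coprime = go (factorise g)
  where
  g = gcd ℤ.∣ i ∣ ℤ.∣ j ∣
  instance _ = ℕ.≢-nonZero (gcd[m,n]≢0 ℤ.∣ i ∣ ℤ.∣ j ∣ (inj₁ (i≢0 ∘ ℤ.∣i∣≡0⇒i≡0)))
  go : PrimeFactorisation g → Σ[ q ∈ ℕ ] Prime q × + q ℤ∣.∣ i × + q ℤ∣.∣ j
  go record { factors = [] ; isFactorisation = g≡1 } = ⊥-elim (¬coprime (ℕC.gcd≡1⇒coprime g≡1))
  go record { factors = q ∷ _ ; isFactorisation = g≡q*_ ; factorsPrime = q-prime ∷ _ } =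
    q , q-prime , ∣ᵤ⇒∣ (ℕ.∣-trans q∣g (gcd[m,n]∣m ℤ.∣ i ∣ ℤ.∣ j ∣))
                , ∣ᵤ⇒∣ (ℕ.∣-trans q∣g (gcd[m,n]∣n ℤ.∣ i ∣ ℤ.∣ j ∣))
    where
    q∣g : q ℕ.∣ g
    q∣g = subst (q ℕ.∣_) (sym g≡q*_) (ℕ.m∣m*n _)

even-or-odd : ∀ n → Σ[ m ∈ ℕ ] (n ≡ m ℕ.+ m ⊎ n ≡ suc (m ℕ.+ m))
even-or-odd zero = 0 , inj₁ refl
even-or-odd (suc n) with even-or-odd n
... | m , inj₁ n≡m+m   = m , inj₂ (cong suc n≡m+m)
... | m , inj₂ n≡1+m+m = suc m , inj₁ (cong suc (trans n≡1+m+m (sym (ℕ.+-suc m m))))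

prime>3⇒odd : ∀ {p} → Prime p → 3 ℕ.< p → Σ[ m ∈ ℕ ] p ≡ suc (m ℕ.+ m) × 2 ℕ.≤ m
prime>3⇒odd {p} p-prime 3<p with even-or-odd p
... | m , inj₁ refl with prime⇒irreducible p-prime (divides m (m+m≡m*2 m))
  where
  m+m≡m*2 : ∀ m → m ℕ.+ m ≡ m ℕ.* 2
  m+m≡m*2 = ℕSolver.solve-∀
...   | inj₁ ()
...   | inj₂ 2≡m+m = contradiction (subst (3 ℕ.<_) (sym 2≡m+m) 3<p) (λ { (ℕ.s≤s (ℕ.s≤s ())) })
prime>3⇒odd p-prime 3<p | zero , inj₂ refl = contradiction 3<p (λ { (ℕ.s≤s ()) })
prime>3⇒odd p-prime 3<p | suc zero , inj₂ refl = contradiction 3<p (λ { (ℕ.s≤s (ℕ.s≤s (ℕ.s≤s ()))) })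
prime>3⇒odd p-prime 3<p | suc (suc m) , inj₂ refl = suc (suc m) , refl , ℕ.s≤s (ℕ.s≤s ℕ.z≤n)

a*a≡D*[b*b]⇒D≡1 : ∀ {D a b} → Squarefree (+ D) → b ≢ 0 → a ℕ.* a ≡ D ℕ.* (b ℕ.* b) → D ≡ 1
a*a≡D*[b*b]⇒D≡1 {D} {a} {b} sqf b≢0 eq = trans (sym a′*a′≡D) (cong (λ n → n ℕ.* n) a′≡1)
  where
  g = gcd a b
  instance _ = ℕ.≢-nonZero (gcd[m,n]≢0 a b (inj₂ b≢0))
  instance _ = ℕ.m*n≢0 g g
  a′ = a / g
  b′ = b / g
  scale : ∀ a′ b′ g → a′ ℕ.* g ℕ.* (a′ ℕ.* g) ≡ D ℕ.* (b′ ℕ.* g ℕ.* (b′ ℕ.* g)) →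
          a′ ℕ.* a′ ℕ.* (g ℕ.* g) ≡ D ℕ.* (b′ ℕ.* b′) ℕ.* (g ℕ.* g)
  scale a′ b′ g e = trans (lhs a′ g) (trans e (rhs D b′ g))
    where
    lhs : ∀ a g → a ℕ.* a ℕ.* (g ℕ.* g) ≡ a ℕ.* g ℕ.* (a ℕ.* g)
    lhs = ℕSolver.solve-∀
    rhs : ∀ D b g → D ℕ.* (b ℕ.* g ℕ.* (b ℕ.* g)) ≡ D ℕ.* (b ℕ.* b) ℕ.* (g ℕ.* g)
    rhs = ℕSolver.solve-∀
  eq′ : a′ ℕ.* a′ ≡ D ℕ.* (b′ ℕ.* b′)
  eq′ = ℕ.*-cancelʳ-≡ _ _ (g ℕ.* g) (scale a′ b′ g (subst₂ (λ x y → x ℕ.* x ≡ D ℕ.* (y ℕ.* y))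
          (sym (m/n*n≡m (gcd[m,n]∣m a b))) (sym (m/n*n≡m (gcd[m,n]∣n a b))) eq))
  coprime : ℕC.Coprime a′ b′
  coprime = ℕC.coprime-/gcd a b
  b′≡1 : b′ ≡ 1
  b′≡1 = coprime (ℕC.coprime-divisor (ℕC.sym coprime) b′∣a′*a′ , ∣-refl)
    where
    b′∣a′*a′ : b′ ℕ.∣ a′ ℕ.* a′
    b′∣a′*a′ = divides (D ℕ.* b′) (trans eq′ (sym (ℕ.*-assoc D b′ b′)))
  a′*a′≡D : a′ ℕ.* a′ ≡ D
  a′*a′≡D = trans eq′ (trans (cong (λ n → D ℕ.* (n ℕ.* n)) b′≡1) (ℕ.*-identityʳ D))
  a′≡1 : a′ ≡ 1
  a′≡1 = sqf a′ (∣-reflexive a′*a′≡D)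

i*i≡+∣i∣*∣i∣ : ∀ i → i ℤ.* i ≡ + (ℤ.∣ i ∣ ℕ.* ℤ.∣ i ∣)
i*i≡+∣i∣*∣i∣ i = trans (cong (ℤ._◃ (ℤ.∣ i ∣ ℕ.* ℤ.∣ i ∣)) (Sign.s*s≡+ (ℤ.sign i))) (ℤ.+◃n≡+n _)

i*i≡-[j*j]⇒j≡0 : ∀ {i j} → i ℤ.* i ≡ ℤ.-[1+ 0 ] ℤ.* (j ℤ.* j) → j ≡ 0ℤ
i*i≡-[j*j]⇒j≡0 {i} {j} eq = ℤ.∣i∣≡0⇒i≡0 ([ id , id ]′ (ℕ.m*n≡0⇒m≡0∨n≡0 ℤ.∣ j ∣ ∣j∣*∣j∣≡0))
  where
  open ≡-Reasoning
  -1*x+x≡0 : ∀ x → ℤ.-[1+ 0 ] ℤ.* x ℤ.+ x ≡ 0ℤ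
  -1*x+x≡0 = solve-∀ℤ
  ∣j∣*∣j∣≡0 : ℤ.∣ j ∣ ℕ.* ℤ.∣ j ∣ ≡ 0
  ∣j∣*∣j∣≡0 = ℕ.m+n≡0⇒n≡0 (ℤ.∣ i ∣ ℕ.* ℤ.∣ i ∣) (ℤ.+-injective (begin
    + (ℤ.∣ i ∣ ℕ.* ℤ.∣ i ∣ ℕ.+ ℤ.∣ j ∣ ℕ.* ℤ.∣ j ∣)
      ≡⟨ cong₂ ℤ._+_ (i*i≡+∣i∣*∣i∣ i) (i*i≡+∣i∣*∣i∣ j) ⟨
    i ℤ.* i ℤ.+ j ℤ.* j                               ≡⟨ cong (ℤ._+ j ℤ.* j) eq ⟩
    ℤ.-[1+ 0 ] ℤ.* (j ℤ.* j) ℤ.+ j ℤ.* j               ≡⟨ -1*x+x≡0 (j ℤ.* j) ⟩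
    0ℤ                                                ∎))

i*i≡d*[j*j]⇒j≡0 : ∀ {d i j} → Squarefree d → d ≢ 1ℤ → i ℤ.* i ≡ d ℤ.* (j ℤ.* j) → j ≡ 0ℤ
i*i≡d*[j*j]⇒j≡0 {d} {i} {j} sqf d≢1 eq with j ℤ.≟ 0ℤ
... | yes j≡0 = j≡0
... | no j≢0 = go d d≢1 eq ∣d∣≡1
  where
  ∣d∣≡1 : ℤ.∣ d ∣ ≡ 1
  ∣d∣≡1 = a*a≡D*[b*b]⇒D≡1 {a = ℤ.∣ i ∣} sqf (λ ∣j∣≡0 → j≢0 (ℤ.∣i∣≡0⇒i≡0 ∣j∣≡0))
    (trans (sym (ℤ.abs-* i i))
      (trans (cong ℤ.∣_∣ eq) (trans (ℤ.abs-* d (j ℤ.* j)) (cong (ℤ.∣ d ∣ ℕ.*_) (ℤ.abs-* j j)))))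
  go : ∀ d → d ≢ 1ℤ → i ℤ.* i ≡ d ℤ.* (j ℤ.* j) → ℤ.∣ d ∣ ≡ 1 → j ≡ 0ℤ
  go (+ n)          d≢1 _  ∣d∣≡1 = contradiction (cong +_ ∣d∣≡1) d≢1
  go ℤ.-[1+ 0 ]     _   eq _     = i*i≡-[j*j]⇒j≡0 {i} eq
  go ℤ.-[1+ suc _ ] _   _  ()

squarefree⇒p²∤d : ∀ {d p} → Squarefree d → Prime p → ¬ (+ p ℤ.* + p ℤ∣.∣ d)
squarefree⇒p²∤d {d} {p} sqf p-prime p²∣d =
  ¬prime[1] (subst Prime (sqf p (subst (ℕ._∣ ℤ.∣ d ∣) (ℤ.abs-* (+ p) (+ p)) (∣⇒∣ᵤ p²∣d))) p-prime)

PthPowerFree⇒≢0 : ∀ {n c} → PthPowerFree n c → c ≢ 0ℤ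
PthPowerFree⇒≢0 {n} c-free refl = c-free 2 prime[2] (ℕ._∣0 (2 ℕ.^ n))

-- Rational numbers

ℚ-ring : ACR.AlmostCommutativeRing 0ℓ 0ℓ
ℚ-ring = ACR.fromCommutativeRing ℚ.+-*-commutativeRing 0≟
  where
  0≟ : (x : ℚ) → Maybe (0ℚ ≡ x)
  0≟ x with 0ℚ ℚ.≟ x
  ... | yes 0≡x = just 0≡x
  ... | no _    = nothing

ι≡mkℚ : ∀ n → ι n ≡ mkℚ n 0 (ℕC.sym (ℕC.1-coprimeTo ℤ.∣ n ∣))
ι≡mkℚ n = ℚ.↥p/↧p≡p (mkℚ n 0 _)

ι-injective : ∀ {m n} → ι m ≡ ι n → m ≡ n
ι-injective {m} {n} ιm≡ιn = cong ↥_ (trans (sym (ι≡mkℚ m)) (trans ιm≡ιn (ι≡mkℚ n)))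

ι-+ : ∀ m n → ι (m ℤ.+ n) ≡ ι m ℚ.+ ι n
ι-+ m n = trans (cong₂ (λ i j → (i ℤ.+ j) ℚ./ 1) (sym (ℤ.*-identityʳ m)) (sym (ℤ.*-identityʳ n)))
                (sym (cong₂ ℚ._+_ (ι≡mkℚ m) (ι≡mkℚ n)))

ι-* : ∀ m n → ι (m ℤ.* n) ≡ ι m ℚ.* ι n
ι-* m n = sym (cong₂ ℚ._*_ (ι≡mkℚ m) (ι≡mkℚ n))

ι-^ : ∀ m k → ι (m ℤ.^ k) ≡ ι m ^ k
ι-^ m zero    = refl
ι-^ m (suc k) = trans (ι-* m (m ℤ.^ k)) (cong (ι m ℚ.*_) (ι-^ m k))

q*ι[↧q*n]≡ι[↥q*n] : ∀ q n → q ℚ.* ι (↧ q ℤ.* n) ≡ ι (↥ q ℤ.* n)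
q*ι[↧q*n]≡ι[↥q*n] q@(mkℚ i k _) n = trans (cong (q ℚ.*_) (ι≡mkℚ (↧ q ℤ.* n)))
  (ℚ.fromℚᵘ-cong {mkℚᵘ (i ℤ.* (↧ q ℤ.* n)) (k ℕ.* 1)} {mkℚᵘ (i ℤ.* n) 0}
    (*≡* (trans (rearrange i (↧ q) n) (cong (λ j → i ℤ.* n ℤ.* + suc j) (sym (ℕ.*-identityʳ k))))))
  where
  rearrange : ∀ i k n → (i ℤ.* (k ℤ.* n)) ℤ.* 1ℤ ≡ (i ℤ.* n) ℤ.* k
  rearrange = solve-∀ℤ

*-cancelˡ-≡0 : ∀ {p q} → p ≢ 0ℚ → p ℚ.* q ≡ 0ℚ → q ≡ 0ℚ
*-cancelˡ-≡0 {p} {q} p≢0 pq≡0 = begin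
  q                        ≡⟨ ℚ.*-identityˡ q ⟨
  1ℚ ℚ.* q                 ≡⟨ cong (ℚ._* q) (ℚ.*-inverseˡ p) ⟨
  ℚ.1/ p ℚ.* p ℚ.* q       ≡⟨ ℚ.*-assoc (ℚ.1/ p) p q ⟩
  ℚ.1/ p ℚ.* (p ℚ.* q)     ≡⟨ cong (ℚ.1/ p ℚ.*_) pq≡0 ⟩
  ℚ.1/ p ℚ.* 0ℚ            ≡⟨ ℚ.*-zeroʳ (ℚ.1/ p) ⟩
  0ℚ                       ∎
  where
  open ≡-Reasoning
  instance _ = ℚ.≢-nonZero p≢0

*-≢0 : ∀ {p q} → p ≢ 0ℚ → q ≢ 0ℚ → p ℚ.* q ≢ 0ℚ
*-≢0 p≢0 q≢0 pq≡0 = q≢0 (*-cancelˡ-≡0 p≢0 pq≡0)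

^-≢0 : ∀ {p} n → p ≢ 0ℚ → p ^ n ≢ 0ℚ
^-≢0 zero    _   ()
^-≢0 (suc n) p≢0 = *-≢0 p≢0 (^-≢0 n p≢0)

ι-≢0 : ∀ {n} → n ≢ 0ℤ → ι n ≢ 0ℚ
ι-≢0 n≢0 ιn≡0 = n≢0 (ι-injective ιn≡0)

↥≢0 : ∀ {q} → q ≢ 0ℚ → ↥ q ≢ 0ℤ
↥≢0 {q} q≢0 ↥q≡0 = q≢0 (ℚ.↥p≡0⇒p≡0 q ↥q≡0)

↧≢0 : ∀ q → ↧ q ≢ 0ℤ
↧≢0 q ()

x+y≡0∧x-y≡0⇒x≡0∧y≡0 : ∀ {x y} → x ℚ.+ y ≡ 0ℚ → x ℚ.- y ≡ 0ℚ → x ≡ 0ℚ × y ≡ 0ℚ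
x+y≡0∧x-y≡0⇒x≡0∧y≡0 {x} {y} x+y≡0 x-y≡0 = x≡0 , trans (sym x≡y) x≡0
  where
  x≡y : x ≡ y
  x≡y = p-q≡0⇒p≡q x y x-y≡0
  2*x≡x+x : ∀ x → (1ℚ ℚ.+ 1ℚ) ℚ.* x ≡ x ℚ.+ x
  2*x≡x+x = solve-∀ ℚ-ring
  x≡0 : x ≡ 0ℚ
  x≡0 = *-cancelˡ-≡0 {1ℚ ℚ.+ 1ℚ} (λ ()) (trans (2*x≡x+x x) (trans (cong (x ℚ.+_) x≡y) x+y≡0))
-- The quadratic field K = ℚ(√d)

module _ {d : ℤ} where

  negK : QF d → QF d
  negK (a +√ b) = (ℚ.- a) +√ (ℚ.- b)

  private
    δ = ι d
    *-assoc-re : ∀ δ a b c e f g → (a ℚ.* c ℚ.+ δ ℚ.* b ℚ.* e) ℚ.* f ℚ.+ δ ℚ.* (a ℚ.* e ℚ.+ b ℚ.* c) ℚ.* g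
                                 ≡ a ℚ.* (c ℚ.* f ℚ.+ δ ℚ.* e ℚ.* g) ℚ.+ δ ℚ.* b ℚ.* (c ℚ.* g ℚ.+ e ℚ.* f)
    *-assoc-re = solve-∀ ℚ-ring
    *-assoc-im : ∀ δ a b c e f g → (a ℚ.* c ℚ.+ δ ℚ.* b ℚ.* e) ℚ.* g ℚ.+ (a ℚ.* e ℚ.+ b ℚ.* c) ℚ.* f
                                 ≡ a ℚ.* (c ℚ.* g ℚ.+ e ℚ.* f) ℚ.+ b ℚ.* (c ℚ.* f ℚ.+ δ ℚ.* e ℚ.* g)
    *-assoc-im = solve-∀ ℚ-ring
    *-comm-re : ∀ δ a b c e → a ℚ.* c ℚ.+ δ ℚ.* b ℚ.* e ≡ c ℚ.* a ℚ.+ δ ℚ.* e ℚ.* b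
    *-comm-re = solve-∀ ℚ-ring
    *-comm-im : ∀ a b c e → a ℚ.* e ℚ.+ b ℚ.* c ≡ c ℚ.* b ℚ.+ e ℚ.* a
    *-comm-im = solve-∀ ℚ-ring
    *-identity-re : ∀ δ a b → 1ℚ ℚ.* a ℚ.+ δ ℚ.* 0ℚ ℚ.* b ≡ a
    *-identity-re = solve-∀ ℚ-ring
    *-identity-im : ∀ a b → 1ℚ ℚ.* b ℚ.+ 0ℚ ℚ.* a ≡ b
    *-identity-im = solve-∀ ℚ-ring
    distrib-re : ∀ δ a b c e f g → a ℚ.* (c ℚ.+ f) ℚ.+ δ ℚ.* b ℚ.* (e ℚ.+ g)
                                 ≡ (a ℚ.* c ℚ.+ δ ℚ.* b ℚ.* e) ℚ.+ (a ℚ.* f ℚ.+ δ ℚ.* b ℚ.* g)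
    distrib-re = solve-∀ ℚ-ring
    distrib-im : ∀ a b c e f g → a ℚ.* (e ℚ.+ g) ℚ.+ b ℚ.* (c ℚ.+ f)
                               ≡ (a ℚ.* e ℚ.+ b ℚ.* c) ℚ.+ (a ℚ.* g ℚ.+ b ℚ.* f)
    distrib-im = solve-∀ ℚ-ring

  *K-comm : ∀ (u v : QF d) → u *K v ≡ v *K u
  *K-comm (a +√ b) (c +√ e) = cong₂ _+√_ (*-comm-re δ a b c e) (*-comm-im a b c e)

  *K-identityˡ : ∀ (u : QF d) → 1K *K u ≡ u
  *K-identityˡ (a +√ b) = cong₂ _+√_ (*-identity-re δ a b) (*-identity-im a b)

  *K-distribˡ-+K : ∀ (u v w : QF d) → u *K (v +K w) ≡ (u *K v) +K (u *K w)
  *K-distribˡ-+K (a +√ b) (c +√ e) (f +√ g) = cong₂ _+√_ (distrib-re δ a b c e f g) (distrib-im a b c e f g)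

  +K-*K-isCommutativeRing : IsCommutativeRing _≡_ (_+K_ {d}) _*K_ negK 0K 1K
  +K-*K-isCommutativeRing = record
    { isRing = record
      { +-isAbelianGroup = record
        { isGroup = record
          { isMonoid = record
            { isSemigroup = record
              { isMagma = record { isEquivalence = isEquivalence ; ∙-cong = cong₂ _+K_ }
              ; assoc = λ { (a +√ b) (c +√ e) (f +√ g) → cong₂ _+√_ (ℚ.+-assoc a c f) (ℚ.+-assoc b e g) } }
            ; identity = (λ { (a +√ b) → cong₂ _+√_ (ℚ.+-identityˡ a) (ℚ.+-identityˡ b) })
                       , (λ { (a +√ b) → cong₂ _+√_ (ℚ.+-identityʳ a) (ℚ.+-identityʳ b) }) }
          ; inverse = (λ { (a +√ b) → cong₂ _+√_ (ℚ.+-inverseˡ a) (ℚ.+-inverseˡ b) })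
                    , (λ { (a +√ b) → cong₂ _+√_ (ℚ.+-inverseʳ a) (ℚ.+-inverseʳ b) })
          ; ⁻¹-cong = cong negK }
        ; comm = λ { (a +√ b) (c +√ e) → cong₂ _+√_ (ℚ.+-comm a c) (ℚ.+-comm b e) } }
      ; *-cong = cong₂ _*K_
      ; *-assoc = λ { (a +√ b) (c +√ e) (f +√ g) → cong₂ _+√_ (*-assoc-re δ a b c e f g) (*-assoc-im δ a b c e f g) }
      ; *-identity = *K-identityˡ , λ u → trans (*K-comm u 1K) (*K-identityˡ u)
      ; distrib = *K-distribˡ-+K , λ u v w → trans (*K-comm (v +K w) u)
                    (trans (*K-distribˡ-+K u v w) (cong₂ _+K_ (*K-comm u v) (*K-comm u w))) }
    ; *-comm = *K-comm }

QF-commutativeRing : ℤ → CommutativeRing 0ℓ 0ℓ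
QF-commutativeRing d = record { isCommutativeRing = +K-*K-isCommutativeRing {d} }

module _ {d : ℤ} where

  open IsCommutativeRing (+K-*K-isCommutativeRing {d}) public
    using () renaming ( *-assoc to *K-assoc; *-identityʳ to *K-identityʳ; distribʳ to *K-distribʳ-+K
                      ; zeroˡ to *K-zeroˡ; zeroʳ to *K-zeroʳ)
  open import Algebra.Properties.CommutativeSemigroup
    (CommutativeRing.*-commutativeSemigroup (QF-commutativeRing d)) using (interchange)

  private
    δ = ι d
    embed-*-re : ∀ δ r a b → r ℚ.* a ℚ.+ δ ℚ.* 0ℚ ℚ.* b ≡ r ℚ.* a
    embed-*-re = solve-∀ ℚ-ring
    embed-*-im : ∀ r a b → r ℚ.* b ℚ.+ 0ℚ ℚ.* a ≡ r ℚ.* b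
    embed-*-im = solve-∀ ℚ-ring
    norm-* : ∀ δ a b c e → (a ℚ.* c ℚ.+ δ ℚ.* b ℚ.* e) ℚ.* (a ℚ.* c ℚ.+ δ ℚ.* b ℚ.* e)
                             ℚ.- δ ℚ.* (a ℚ.* e ℚ.+ b ℚ.* c) ℚ.* (a ℚ.* e ℚ.+ b ℚ.* c)
                         ≡ (a ℚ.* a ℚ.- δ ℚ.* b ℚ.* b) ℚ.* (c ℚ.* c ℚ.- δ ℚ.* e ℚ.* e)
    norm-* = solve-∀ ℚ-ring
    inverse-re : ∀ δ a b r → a ℚ.* r ℚ.* a ℚ.+ δ ℚ.* (ℚ.- (b ℚ.* r)) ℚ.* b
                           ≡ (a ℚ.* a ℚ.- δ ℚ.* b ℚ.* b) ℚ.* r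
    inverse-re = solve-∀ ℚ-ring
    inverse-im : ∀ a b r → a ℚ.* r ℚ.* b ℚ.+ (ℚ.- (b ℚ.* r)) ℚ.* a ≡ 0ℚ
    inverse-im = solve-∀ ℚ-ring

  ^K-distrib-*K : ∀ (u v : QF d) n → (u *K v) ^K n ≡ (u ^K n) *K (v ^K n)
  ^K-distrib-*K u v zero    = sym (*K-identityˡ 1K)
  ^K-distrib-*K u v (suc n) = trans (cong ((u *K v) *K_) (^K-distrib-*K u v n)) (interchange u v (u ^K n) (v ^K n))

  embed-*K : ∀ r (u : QF d) → embed r *K u ≡ (r ℚ.* re u) +√ (r ℚ.* im u)
  embed-*K r (a +√ b) = cong₂ _+√_ (embed-*-re δ r a b) (embed-*-im r a b)

  embed-*K-embed : ∀ r s → embed {d} r *K embed s ≡ embed (r ℚ.* s)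
  embed-*K-embed r s = trans (embed-*K r (embed s)) (cong ((r ℚ.* s) +√_) (ℚ.*-zeroʳ r))

  embed-^K : ∀ r n → embed {d} r ^K n ≡ embed (r ^ n)
  embed-^K r zero    = refl
  embed-^K r (suc n) = trans (cong (embed r *K_) (embed-^K r n)) (embed-*K-embed r (r ^ n))

  im-[embed*K]^K : ∀ c (u : QF d) n → im ((embed c *K u) ^K n) ≡ c ^ n ℚ.* im (u ^K n)
  im-[embed*K]^K c u n = cong im (trans (^K-distrib-*K (embed c) u n)
    (trans (cong (_*K (u ^K n)) (embed-^K c n)) (embed-*K (c ^ n) (u ^K n))))

  normK-*K : ∀ (u v : QF d) → normK (u *K v) ≡ normK u ℚ.* normK v
  normK-*K (a +√ b) (c +√ e) = norm-* δ a b c e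

  invK-inverseˡ : ∀ (u : QF d) → normK u ≢ 0ℚ → invK u *K u ≡ 1K
  invK-inverseˡ (a +√ b) N≢0 with a ℚ.* a ℚ.+ ℚ.- (ι d ℚ.* b ℚ.* b) ℚ.≟ 0ℚ
  ... | yes N≡0 = contradiction N≡0 N≢0
  ... | no _    = cong₂ _+√_ (trans (inverse-re δ a b _) (ℚ.*-inverseʳ (normK {d} (a +√ b)))) (inverse-im a b _)
    where instance _ = ℚ.≢-nonZero N≢0

  normK-0K : normK {d} 0K ≡ 0ℚ
  normK-0K = norm-zero δ
    where
    norm-zero : ∀ δ → 0ℚ ℚ.* 0ℚ ℚ.- δ ℚ.* 0ℚ ℚ.* 0ℚ ≡ 0ℚ
    norm-zero = solve-∀ ℚ-ring

  integral-multiple : ∀ (u : QF d) → Σ[ c ∈ ℚ ] c ≢ 0ℚ × Σ[ i ∈ ℤ ] Σ[ j ∈ ℤ ] embed c *K u ≡ ι i +√ ι j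
  integral-multiple u@(a +√ b) = c , c≢0 , ↥ a ℤ.* ↧ b , ↥ b ℤ.* ↧ a
    , trans (embed-*K c u) (cong₂ _+√_ (trans (ℚ.*-comm c a) (q*ι[↧q*n]≡ι[↥q*n] a (↧ b)))
        (trans (ℚ.*-comm c b) (trans (cong (λ n → b ℚ.* ι n) (ℤ.*-comm (↧ a) (↧ b))) (q*ι[↧q*n]≡ι[↥q*n] b (↧ a)))))
    where
    c = ι (↧ a ℤ.* ↧ b)
    c≢0 : c ≢ 0ℚ
    c≢0 = ι-≢0 (*-≢0ℤ (↧≢0 a) (↧≢0 b))

module _ {d : ℤ} (sqf : Squarefree d) (d≢1 : d ≢ 1ℤ) where

  private
    δ = ι d
    norm-real : ∀ δ a → a ℚ.* a ℚ.- δ ℚ.* 0ℚ ℚ.* 0ℚ ≡ a ℚ.* a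
    norm-real = solve-∀ ℚ-ring

  normK≡0⇒≡0K : ∀ (u : QF d) → normK u ≡ 0ℚ → u ≡ 0K
  normK≡0⇒≡0K u N≡0 = go (integral-multiple u)
    where
    go : Σ[ c ∈ ℚ ] c ≢ 0ℚ × Σ[ i ∈ ℤ ] Σ[ j ∈ ℤ ] embed c *K u ≡ ι i +√ ι j → u ≡ 0K
    go (c , c≢0 , i , j , cu≡i+√j) = cong₂ _+√_ re≡0 im≡0
      where
      i*i≡d*[j*j] : i ℤ.* i ≡ d ℤ.* (j ℤ.* j)
      i*i≡d*[j*j] = ι-injective {i ℤ.* i} {d ℤ.* (j ℤ.* j)} (begin
        ι (i ℤ.* i)                    ≡⟨ ι-* i i ⟩
        ι i ℚ.* ι i                    ≡⟨ p-q≡0⇒p≡q (ι i ℚ.* ι i) (δ ℚ.* ι j ℚ.* ι j) (begin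
          normK {d} (ι i +√ ι j)         ≡⟨ cong normK cu≡i+√j ⟨
          normK (embed c *K u)           ≡⟨ normK-*K (embed {d} c) u ⟩
          normK (embed {d} c) ℚ.* normK u ≡⟨ cong (normK (embed {d} c) ℚ.*_) N≡0 ⟩
          normK (embed {d} c) ℚ.* 0ℚ      ≡⟨ ℚ.*-zeroʳ (normK (embed {d} c)) ⟩
          0ℚ                             ∎) ⟩
        δ ℚ.* ι j ℚ.* ι j              ≡⟨ ℚ.*-assoc δ (ι j) (ι j) ⟩
        δ ℚ.* (ι j ℚ.* ι j)            ≡⟨ cong (δ ℚ.*_) (ι-* j j) ⟨
        δ ℚ.* ι (j ℤ.* j)              ≡⟨ ι-* d (j ℤ.* j) ⟨
        ι (d ℤ.* (j ℤ.* j))            ∎)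
        where open ≡-Reasoning
      im≡0 : im u ≡ 0ℚ
      im≡0 = *-cancelˡ-≡0 c≢0 (trans (cong im (trans (sym (embed-*K c u)) cu≡i+√j))
                                     (cong ι (i*i≡d*[j*j]⇒j≡0 {i = i} {j} sqf d≢1 i*i≡d*[j*j])))
      re≡0 : re u ≡ 0ℚ
      re≡0 with re u ℚ.≟ 0ℚ
      ... | yes re≡0 = re≡0
      ... | no re≢0  = contradiction
        (trans (sym (norm-real δ (re u))) (subst (λ b → re u ℚ.* re u ℚ.- δ ℚ.* b ℚ.* b ≡ 0ℚ) im≡0 N≡0))
        (*-≢0 re≢0 re≢0)

  normK-≢0 : ∀ {u : QF d} → u ≢ 0K → normK u ≢ 0ℚ
  normK-≢0 u≢0 N≡0 = u≢0 (normK≡0⇒≡0K _ N≡0)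

  *K-≢0K : ∀ {u v : QF d} → u ≢ 0K → v ≢ 0K → u *K v ≢ 0K
  *K-≢0K {u} {v} u≢0 v≢0 uv≡0 = *-≢0 (normK-≢0 u≢0) (normK-≢0 v≢0)
    (trans (sym (normK-*K u v)) (trans (cong normK uv≡0) (normK-0K {d})))

  ^K-≢0K : ∀ {u : QF d} n → u ≢ 0K → u ^K n ≢ 0K
  ^K-≢0K zero    _   ()
  ^K-≢0K (suc n) u≢0 = *K-≢0K u≢0 (^K-≢0K n u≢0)

  /K*K-cancel : ∀ (u : QF d) {v} → v ≢ 0K → (u /K v) *K v ≡ u
  /K*K-cancel u {v} v≢0 =
    trans (*K-assoc u (invK v) v) (trans (cong (u *K_) (invK-inverseˡ v (normK-≢0 v≢0))) (*K-identityʳ u))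

  *K/K-cancel : ∀ (u : QF d) {v} → v ≢ 0K → (u *K v) /K v ≡ u
  *K/K-cancel u {v} v≢0 = begin
    (u *K v) *K invK v       ≡⟨ *K-assoc u v (invK v) ⟩
    u *K (v *K invK v)       ≡⟨ cong (u *K_) (*K-comm v (invK v)) ⟩
    u *K (invK v *K v)       ≡⟨ cong (u *K_) (invK-inverseˡ v (normK-≢0 v≢0)) ⟩
    u *K 1K                  ≡⟨ *K-identityʳ u ⟩
    u                        ∎
    where open ≡-Reasoning

  *K-cancelʳ : ∀ {u w v : QF d} → v ≢ 0K → u *K v ≡ w *K v → u ≡ w
  *K-cancelʳ {u} {w} {v} v≢0 uv≡wv =
    trans (sym (*K/K-cancel u v≢0)) (trans (cong (_/K v) uv≡wv) (*K/K-cancel w v≢0))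

-- p-th powers in K

module PowerExpansion (d : ℤ) where

  private
    R = QF-commutativeRing d
    module R = CommutativeRing R
    δ = ι d
  open import Algebra.Properties.Semiring.Exp R.semiring using () renaming (_^_ to _^ᴿ_)
  open import Algebra.Properties.Semiring.Mult R.semiring using () renaming (_×_ to _×ᴿ_)
  open import Algebra.Properties.CommutativeSemiring.Binomial R.commutativeSemiring using (theorem; binomialTerm)

  db² : ℤ → ℤ
  db² b = d ℤ.* (b ℤ.* b)

  im[b√d]^ : ℤ → ℕ → ℤ
  im[b√d]^ b zero          = 0ℤ
  im[b√d]^ b (suc zero)    = b
  im[b√d]^ b (suc (suc k)) = db² b ℤ.* im[b√d]^ b k

  im-[√d]^K : ∀ b k → im {d} ((0ℚ +√ ι b) ^K k) ≡ ι (im[b√d]^ b k)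
  im-[√d]^K b zero          = refl
  im-[√d]^K b (suc zero)    = im-√d δ (ι b)
    where
    im-√d : ∀ δ b → 0ℚ ℚ.* 0ℚ ℚ.+ b ℚ.* 1ℚ ≡ b
    im-√d = solve-∀ ℚ-ring
  im-[√d]^K b (suc (suc k)) = begin
    im (w *K (w *K (w ^K k)))          ≡⟨ cong im (*K-assoc w w (w ^K k)) ⟨
    im ((w *K w) *K (w ^K k))          ≡⟨ cong (λ v → im (v *K (w ^K k))) w*w≡db² ⟩
    im (embed (ι (db² b)) *K (w ^K k))   ≡⟨ cong im (embed-*K (ι (db² b)) (w ^K k)) ⟩
    ι (db² b) ℚ.* im (w ^K k)          ≡⟨ cong (ι (db² b) ℚ.*_) (im-[√d]^K b k) ⟩
    ι (db² b) ℚ.* ι (im[b√d]^ b k)        ≡⟨ ι-* (db² b) (im[b√d]^ b k) ⟨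
    ι (db² b ℤ.* im[b√d]^ b k)            ∎
    where
    open ≡-Reasoning
    w : QF d
    w = 0ℚ +√ ι b
    re-lemma : ∀ δ b → 0ℚ ℚ.* 0ℚ ℚ.+ δ ℚ.* b ℚ.* b ≡ δ ℚ.* (b ℚ.* b)
    re-lemma = solve-∀ ℚ-ring
    im-lemma : ∀ b → 0ℚ ℚ.* b ℚ.+ b ℚ.* 0ℚ ≡ 0ℚ
    im-lemma = solve-∀ ℚ-ring
    w*w≡db² : w *K w ≡ embed (ι (db² b))
    w*w≡db² = cong₂ _+√_ (trans (re-lemma δ (ι b)) (sym (trans (ι-* d (b ℤ.* b)) (cong (δ ℚ.*_) (ι-* b b)))))
                       (im-lemma (ι b))

  imTerm : ℕ → ℤ → ℤ → ℕ → ℤ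
  imTerm n a b k = + (n ℕ.C k) ℤ.* (a ℤ.^ (n ℕ.∸ k) ℤ.* im[b√d]^ b k)

  im-^K : ∀ n a b → im {d} ((ι a +√ ι b) ^K n) ≡ ι (∑ℤ {suc n} (imTerm n a b ∘ toℕ))
  im-^K n a b = begin
    im ((ι a +√ ι b) ^K n)              ≡⟨ cong (λ u → im (u ^K n)) a+√b≡w+y ⟩
    im ((w +K y) ^K n)                  ≡⟨ cong im (^K≡^ᴿ (w +K y) n) ⟩
    im ((w +K y) ^ᴿ n)                  ≡⟨ cong im (theorem n w y) ⟩
    im (Sum.sum R.+-monoid (binomialTerm w y n))
      ≡⟨ sum-homo R.+-monoid ℚ.+-0-monoid im refl (λ _ _ → refl) (binomialTerm w y n) ⟩
    Sum.sum ℚ.+-0-monoid (im ∘ binomialTerm w y n)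
      ≡⟨ Sum.sum-cong-≗ ℚ.+-0-monoid im-term ⟩
    Sum.sum ℚ.+-0-monoid {suc n} (ι ∘ imTerm n a b ∘ toℕ)
      ≡⟨ sum-homo ℤ.+-0-monoid ℚ.+-0-monoid ι refl ι-+ {suc n} (imTerm n a b ∘ toℕ) ⟨
    ι (∑ℤ {suc n} (imTerm n a b ∘ toℕ))              ∎
    where
    open ≡-Reasoning
    w y : QF d
    w = 0ℚ +√ ι b
    y = embed (ι a)
    a+√b≡w+y : ι a +√ ι b ≡ w +K y
    a+√b≡w+y = cong₂ _+√_ (sym (ℚ.+-identityˡ (ι a))) (sym (ℚ.+-identityʳ (ι b)))
    ^K≡^ᴿ : ∀ u k → u ^K k ≡ u ^ᴿ k
    ^K≡^ᴿ u zero    = refl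
    ^K≡^ᴿ u (suc k) = cong (u *K_) (^K≡^ᴿ u k)
    1+x*y : ∀ x y → (1ℚ ℚ.+ x) ℚ.* y ≡ y ℚ.+ x ℚ.* y
    1+x*y = solve-∀ ℚ-ring
    im-× : ∀ c u → im (c ×ᴿ u) ≡ ι (+ c) ℚ.* im u
    im-× zero    u = sym (ℚ.*-zeroˡ (im u))
    im-× (suc c) u = trans (cong (im u ℚ.+_) (im-× c u))
      (sym (trans (cong (ℚ._* im u) (ι-+ 1ℤ (+ c))) (1+x*y (ι (+ c)) (im u))))
    im-term : ∀ k → im (binomialTerm w y n k) ≡ ι (imTerm n a b (toℕ k))
    im-term k = begin
      im ((n ℕ.C j) ×ᴿ ((w ^ᴿ j) *K (y ^ᴿ (n ℕ.∸ j))))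
        ≡⟨ im-× (n ℕ.C j) ((w ^ᴿ j) *K (y ^ᴿ (n ℕ.∸ j))) ⟩
      ι (+ (n ℕ.C j)) ℚ.* im ((w ^ᴿ j) *K (y ^ᴿ (n ℕ.∸ j)))
        ≡⟨ cong (λ u → ι (+ (n ℕ.C j)) ℚ.* im u) (trans (*K-comm (w ^ᴿ j) (y ^ᴿ (n ℕ.∸ j)))
             (cong₂ _*K_ (sym (^K≡^ᴿ y (n ℕ.∸ j))) (sym (^K≡^ᴿ w j)))) ⟩
      ι (+ (n ℕ.C j)) ℚ.* im ((y ^K (n ℕ.∸ j)) *K (w ^K j))
        ≡⟨ cong (λ u → ι (+ (n ℕ.C j)) ℚ.* im (u *K (w ^K j)))
             (trans (embed-^K (ι a) (n ℕ.∸ j)) (cong embed (sym (ι-^ a (n ℕ.∸ j))))) ⟩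
      ι (+ (n ℕ.C j)) ℚ.* im (embed (ι (a ℤ.^ (n ℕ.∸ j))) *K (w ^K j))
        ≡⟨ cong (λ q → ι (+ (n ℕ.C j)) ℚ.* q) (trans (cong im (embed-*K (ι (a ℤ.^ (n ℕ.∸ j))) (w ^K j)))
             (cong (ι (a ℤ.^ (n ℕ.∸ j)) ℚ.*_) (im-[√d]^K b j))) ⟩
      ι (+ (n ℕ.C j)) ℚ.* (ι (a ℤ.^ (n ℕ.∸ j)) ℚ.* ι (im[b√d]^ b j))
        ≡⟨ trans (ι-* (+ (n ℕ.C j)) _) (cong (ι (+ (n ℕ.C j)) ℚ.*_) (ι-* (a ℤ.^ (n ℕ.∸ j)) (im[b√d]^ b j))) ⟨
      ι (imTerm n a b j) ∎
      where j = toℕ k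

module _ {d : ℤ} {m : ℕ} (p-prime : Prime (suc (m ℕ.+ m))) (2≤m : 2 ℕ.≤ m)
         (p²∤d : ¬ (+ suc (m ℕ.+ m) ℤ.* + suc (m ℕ.+ m) ℤ∣.∣ d)) where

  open PowerExpansion d

  private
    p : ℕ
    p = suc (m ℕ.+ m)
    5≤p : 5 ℕ.≤ p
    5≤p = ℕ.s≤s (ℕ.+-mono-≤ 2≤m 2≤m)
    P : ℤ
    P = + p

  b∣im[b√d]^ : ∀ b k → b ℤ∣.∣ im[b√d]^ b k
  b∣im[b√d]^ b zero          = ∣0 b
  b∣im[b√d]^ b (suc zero)    = ℤ∣.∣-refl
  b∣im[b√d]^ b (suc (suc k)) = ℤ∣.∣n⇒∣m*n (db² b) (b∣im[b√d]^ b k)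

  im[b√d]^-odd : ∀ b j → im[b√d]^ b (suc (j ℕ.+ j)) ≡ db² b ℤ.^ j ℤ.* b
  im[b√d]^-odd b zero    = sym (ℤ.*-identityˡ b)
  im[b√d]^-odd b (suc j) = begin
    db² b ℤ.* im[b√d]^ b (j ℕ.+ suc j)       ≡⟨ cong (λ k → db² b ℤ.* im[b√d]^ b k) (ℕ.+-suc j j) ⟩
    db² b ℤ.* im[b√d]^ b (suc (j ℕ.+ j))     ≡⟨ cong (db² b ℤ.*_) (im[b√d]^-odd b j) ⟩
    db² b ℤ.* (db² b ℤ.^ j ℤ.* b)           ≡⟨ ℤ.*-assoc (db² b) (db² b ℤ.^ j) b ⟨
    db² b ℤ.^ suc j ℤ.* b                 ∎
    where open ≡-Reasoning

  imTerm-0 : ∀ a b → imTerm p a b 0 ≡ 0ℤ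
  imTerm-0 a b = trans (cong (+ (p ℕ.C 0) ℤ.*_) (ℤ.*-zeroʳ (a ℤ.^ p))) (ℤ.*-zeroʳ (+ (p ℕ.C 0)))

  imTerm-1 : ∀ a b → imTerm p a b 1 ≡ P ℤ.* (a ℤ.^ (m ℕ.+ m) ℤ.* b)
  imTerm-1 a b = cong (λ c → + c ℤ.* (a ℤ.^ (m ℕ.+ m) ℤ.* b)) (ℕ.nC1≡n p)

  imTerm-p : ∀ a b → imTerm p a b p ≡ db² b ℤ.^ m ℤ.* b
  imTerm-p a b = begin
    + (p ℕ.C p) ℤ.* (a ℤ.^ (p ℕ.∸ p) ℤ.* im[b√d]^ b p)
      ≡⟨ cong₂ (λ c e → + c ℤ.* (a ℤ.^ e ℤ.* im[b√d]^ b p)) (ℕ.nCn≡1 p) (ℕ.n∸n≡0 p) ⟩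
    1ℤ ℤ.* (1ℤ ℤ.* im[b√d]^ b p)   ≡⟨ trans (ℤ.*-identityˡ _) (ℤ.*-identityˡ (im[b√d]^ b p)) ⟩
    im[b√d]^ b p                   ≡⟨ im[b√d]^-odd b m ⟩
    db² b ℤ.^ m ℤ.* b             ∎
    where open ≡-Reasoning

  P∣pCk : ∀ {k} → 0 ℕ.< k → k ℕ.< p → P ℤ∣.∣ + (p ℕ.C k)
  P∣pCk 0<k k<p = ∣ᵤ⇒∣ (prime∣pCk p-prime 0<k k<p)

  P∣imTerm : ∀ a b k → k ℕ.< p → P ℤ∣.∣ imTerm p a b k
  P∣imTerm a b zero    _   = subst (P ℤ∣.∣_) (sym (imTerm-0 a b)) (∣0 P)
  P∣imTerm a b (suc k) k<p = ℤ∣.∣m⇒∣m*n _ (P∣pCk ℕ.z<s k<p)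

  ∣imTerm-at : ∀ {N a b} k₀ → k₀ ℕ.≤ p → (∀ k → k ℕ.≤ p → k ≢ k₀ → N ℤ∣.∣ imTerm p a b k) →
          ∑ℤ {suc p} (imTerm p a b ∘ toℕ) ≡ 0ℤ → N ℤ∣.∣ imTerm p a b k₀
  ∣imTerm-at {N} {a} {b} k₀ k₀≤p N∣imTerm ∑≡0 =
    subst (λ k → N ℤ∣.∣ imTerm p a b k) (Fin.toℕ-fromℕ< (ℕ.s≤s k₀≤p))
    (∣-∑ℤ-except (imTerm p a b ∘ toℕ) (fromℕ< (ℕ.s≤s k₀≤p))
      (λ j j≢k₀ → N∣imTerm (toℕ j) (ℕ.s≤s⁻¹ (Fin.toℕ<n j))
        (λ j≡k₀ → j≢k₀ (Fin.toℕ-injective (trans j≡k₀ (sym (Fin.toℕ-fromℕ< (ℕ.s≤s k₀≤p)))))))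
      (subst (N ℤ∣.∣_) (sym ∑≡0) (∣0 N)))

  module _ {b : ℤ} (P∣db² : P ℤ∣.∣ db² b) where

    P^i∣im[b√d]^ : ∀ i k → suc (i ℕ.+ i) ℕ.≤ k → P ℤ.^ i ℤ∣.∣ im[b√d]^ b k
    P^i∣im[b√d]^ zero    k             _  = 1∣ (im[b√d]^ b k)
    P^i∣im[b√d]^ (suc i) (suc zero)    (ℕ.s≤s ())
    P^i∣im[b√d]^ (suc i) (suc (suc k)) le =
      *-pres-∣ P∣db² (P^i∣im[b√d]^ i k (subst (ℕ._≤ k) (ℕ.+-suc i i) (ℕ.s≤s⁻¹ (ℕ.s≤s⁻¹ le))))

    P*b∣im[b√d]^ : ∀ k → P ℤ.* b ℤ∣.∣ im[b√d]^ b (suc (suc k))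
    P*b∣im[b√d]^ k = *-pres-∣ P∣db² (b∣im[b√d]^ b k)

    P*[P*b]∣im[b√d]^ : ∀ k → P ℤ.* (P ℤ.* b) ℤ∣.∣ im[b√d]^ b (suc (suc (suc (suc k))))
    P*[P*b]∣im[b√d]^ k = *-pres-∣ P∣db² (P*b∣im[b√d]^ k)

    -- Terms with k = 2, 3 get their second factor P from the binomial coefficient, those with
    -- k ≥ 4 (including k = p, as p ≥ 5) from (db²)².
    P*[P*b]∣imTerm : ∀ a k → k ℕ.≤ p → k ≢ 1 → P ℤ.* (P ℤ.* b) ℤ∣.∣ imTerm p a b k
    P*[P*b]∣imTerm a zero                          _ _   = subst (_ ℤ∣.∣_) (sym (imTerm-0 a b)) (∣0 _)
    P*[P*b]∣imTerm a (suc zero)                    _ k≢1 = contradiction refl k≢1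
    P*[P*b]∣imTerm a (suc (suc zero))              _ _   =
      *-pres-∣ (P∣pCk ℕ.z<s 2<p) (ℤ∣.∣n⇒∣m*n (a ℤ.^ (p ℕ.∸ 2)) (P*b∣im[b√d]^ 0))
      where 2<p = ℕ.≤-trans (ℕ.s≤s (ℕ.s≤s (ℕ.s≤s ℕ.z≤n))) 5≤p
    P*[P*b]∣imTerm a (suc (suc (suc zero)))        _ _   =
      *-pres-∣ (P∣pCk ℕ.z<s 3<p) (ℤ∣.∣n⇒∣m*n (a ℤ.^ (p ℕ.∸ 3)) (P*b∣im[b√d]^ 1))
      where 3<p = ℕ.≤-trans (ℕ.s≤s (ℕ.s≤s (ℕ.s≤s (ℕ.s≤s ℕ.z≤n)))) 5≤p
    P*[P*b]∣imTerm a k@(suc (suc (suc (suc k′)))) _ _ =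
      ℤ∣.∣n⇒∣m*n (+ (p ℕ.C k)) (ℤ∣.∣n⇒∣m*n (a ℤ.^ (p ℕ.∸ k)) (P*[P*b]∣im[b√d]^ k′))

    module _ {a : ℤ} (P∣a : P ℤ∣.∣ a) where

      P^i∣aⁿ*im[b√d]^ : ∀ i n k → suc (i ℕ.+ i) ℕ.≤ k ℕ.+ (n ℕ.+ n) →
                        P ℤ.^ i ℤ∣.∣ a ℤ.^ n ℤ.* im[b√d]^ b k
      P^i∣aⁿ*im[b√d]^ zero    n       k _  = 1∣ _
      P^i∣aⁿ*im[b√d]^ (suc i) zero    k le =
        ℤ∣.∣n⇒∣m*n 1ℤ (P^i∣im[b√d]^ (suc i) k (subst (_ ℕ.≤_) (ℕ.+-identityʳ k) le))
      P^i∣aⁿ*im[b√d]^ (suc i) (suc n) k le = subst (_ ℤ∣.∣_) (sym (ℤ.*-assoc a (a ℤ.^ n) (im[b√d]^ b k)))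
        (*-pres-∣ P∣a (P^i∣aⁿ*im[b√d]^ i n k (ℕ.s≤s⁻¹ (ℕ.s≤s⁻¹ (subst₂ ℕ._≤_ lhs rhs le)))))
        where
        lhs : suc (suc i ℕ.+ suc i) ≡ suc (suc (suc (i ℕ.+ i)))
        lhs = cong (λ n → ℕ.suc (ℕ.suc n)) (ℕ.+-suc i i)
        rhs : k ℕ.+ (suc n ℕ.+ suc n) ≡ suc (suc (k ℕ.+ (n ℕ.+ n)))
        rhs = trans (cong (k ℕ.+_) (cong suc (ℕ.+-suc n n))) (trans (ℕ.+-suc k _) (cong suc (ℕ.+-suc k (n ℕ.+ n))))

      P^[m+1]∣imTerm : ∀ k → k ℕ.< p → P ℤ.^ suc m ℤ∣.∣ imTerm p a b k
      P^[m+1]∣imTerm zero    _   = subst (_ ℤ∣.∣_) (sym (imTerm-0 a b)) (∣0 _)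
      P^[m+1]∣imTerm (suc k) k<p = *-pres-∣ (P∣pCk ℕ.z<s k<p) (P^i∣aⁿ*im[b√d]^ m e (suc k)
          (subst (ℕ._≤ suc k ℕ.+ (e ℕ.+ e)) (ℕ.m+[n∸m]≡n (ℕ.<⇒≤ k<p)) (ℕ.+-monoʳ-≤ (suc k) (ℕ.m≤m+n e e))))
        where e = p ℕ.∸ suc k

  P^[m+1]∤[db²]ᵐ*b : ∀ {b} → ¬ P ℤ∣.∣ b → P ℤ∣.∣ d → ¬ P ℤ.^ suc m ℤ∣.∣ db² b ℤ.^ m ℤ.* b
  P^[m+1]∤[db²]ᵐ*b {b} P∤b (divides r d≡r*P) P^[m+1]∣ = [ P∤W ∘ prime∣i^n⇒prime∣i p-prime m , P∤b ]′
    (euclidsLemmaℤ p-prime (W ℤ.^ m) b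
      (ℤ∣.*-cancelˡ-∣ (P ℤ.^ m) (subst₂ ℤ∣._∣_ (ℤ.*-comm P (P ℤ.^ m)) [db²]ᵐ*b≡ P^[m+1]∣)))
    where
    instance _ = ℤ.≢-nonZero (λ Pᵐ≡0 → contradiction (ℤ.i^n≡0⇒i≡0 P m Pᵐ≡0) (λ ()))
    W = r ℤ.* (b ℤ.* b)
    db²≡P*W : ∀ r P b → r ℤ.* P ℤ.* (b ℤ.* b) ≡ P ℤ.* (r ℤ.* (b ℤ.* b))
    db²≡P*W = solve-∀ℤ
    [db²]ᵐ*b≡ : db² b ℤ.^ m ℤ.* b ≡ P ℤ.^ m ℤ.* (W ℤ.^ m ℤ.* b)
    [db²]ᵐ*b≡ = begin
      db² b ℤ.^ m ℤ.* b
        ≡⟨ cong (λ v → v ℤ.^ m ℤ.* b) (trans (cong (ℤ._* (b ℤ.* b)) d≡r*P) (db²≡P*W r P b)) ⟩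
      (P ℤ.* W) ℤ.^ m ℤ.* b          ≡⟨ cong (ℤ._* b) (^-distribʳ-* P W m) ⟩
      P ℤ.^ m ℤ.* W ℤ.^ m ℤ.* b      ≡⟨ ℤ.*-assoc (P ℤ.^ m) (W ℤ.^ m) b ⟩
      P ℤ.^ m ℤ.* (W ℤ.^ m ℤ.* b)    ∎
      where open ≡-Reasoning
    P∤r : ¬ P ℤ∣.∣ r
    P∤r (divides s refl) = p²∤d (divides s (trans d≡r*P (ℤ.*-assoc s P P)))
    P∤W : ¬ P ℤ∣.∣ W
    P∤W P∣W = [ P∤r , [ P∤b , P∤b ]′ ∘ euclidsLemmaℤ p-prime b b ]′ (euclidsLemmaℤ p-prime r (b ℤ.* b) P∣W)

  ∑imTerm≢0 : ∀ {a b} → b ≢ 0ℤ → ¬ (P ℤ∣.∣ a × P ℤ∣.∣ b) → ∑ℤ {suc p} (imTerm p a b ∘ toℕ) ≢ 0ℤ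
  ∑imTerm≢0 {a} {b} b≢0 P∤a∨P∤b ∑≡0 = P^[m+1]∤[db²]ᵐ*b P∤b P∣d
    (subst (_ ℤ∣.∣_) (imTerm-p a b)
      (∣imTerm-at p ℕ.≤-refl (λ k k≤p k≢p → P^[m+1]∣imTerm P∣db² P∣a k (ℕ.≤∧≢⇒< k≤p k≢p)) ∑≡0))
    where
    instance _ = ℤ.≢-nonZero b≢0
    P∣db² : P ℤ∣.∣ db² b
    P∣db² = [ prime∣i^n⇒prime∣i p-prime m , (λ P∣b → ℤ∣.∣n⇒∣m*n d (ℤ∣.∣m⇒∣m*n b P∣b)) ]′
      (euclidsLemmaℤ p-prime (db² b ℤ.^ m) b (subst (P ℤ∣.∣_) (imTerm-p a b)
        (∣imTerm-at p ℕ.≤-refl (λ k k≤p k≢p → P∣imTerm a b k (ℕ.≤∧≢⇒< k≤p k≢p)) ∑≡0)))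
    P∣a : P ℤ∣.∣ a
    P∣a = prime∣i^n⇒prime∣i p-prime (m ℕ.+ m) (ℤ∣.*-cancelʳ-∣ b (ℤ∣.*-cancelˡ-∣ P
      (subst (P ℤ.* (P ℤ.* b) ℤ∣.∣_) (imTerm-1 a b)
        (∣imTerm-at 1 (ℕ.s≤s ℕ.z≤n) (P*[P*b]∣imTerm P∣db² a) ∑≡0))))
    P∤b : ¬ P ℤ∣.∣ b
    P∤b P∣b = P∤a∨P∤b (P∣a , P∣b)
    P∣d : P ℤ∣.∣ d
    P∣d = [ id , (λ P∣b*b → contradiction ([ id , id ]′ (euclidsLemmaℤ p-prime b b P∣b*b)) P∤b) ]′
      (euclidsLemmaℤ p-prime d (b ℤ.* b) P∣db²)

  im-^K≢0 : ∀ a b → b ≢ 0ℤ → im {d} ((ι a +√ ι b) ^K p) ≢ 0ℚ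
  im-^K≢0 a b = go a b (<-wellFounded ℤ.∣ b ∣)
    where
    go : ∀ a b → Acc ℕ._<_ ℤ.∣ b ∣ → b ≢ 0ℤ → im {d} ((ι a +√ ι b) ^K p) ≢ 0ℚ
    go a b (acc rec) b≢0 im≡0 with P ℤ∣.∣? a | P ℤ∣.∣? b
    ... | no P∤a | _      = ∑imTerm≢0 {a} b≢0 (P∤a ∘ proj₁) (ι-injective (trans (sym (im-^K p a b)) im≡0))
    ... | yes _  | no P∤b = ∑imTerm≢0 {a} b≢0 (P∤b ∘ proj₂) (ι-injective (trans (sym (im-^K p a b)) im≡0))
    ... | yes (divides a′ refl) | yes (divides b′ refl) =
      go a′ b′ (rec ∣b′∣<∣b′*P∣) b′≢0 (*-cancelˡ-≡0 (^-≢0 p (ι-≢0 {P} (λ ()))) (begin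
        ι P ^ p ℚ.* im ((ι a′ +√ ι b′) ^K p)               ≡⟨ im-[embed*K]^K (ι P) (ι a′ +√ ι b′) p ⟨
        im ((embed (ι P) *K (ι a′ +√ ι b′)) ^K p)           ≡⟨ cong (λ u → im (u ^K p)) scale ⟩
        im ((ι (a′ ℤ.* P) +√ ι (b′ ℤ.* P)) ^K p)           ≡⟨ im≡0 ⟩
        0ℚ                                                 ∎))
      where
      open ≡-Reasoning
      b′≢0 : b′ ≢ 0ℤ
      b′≢0 b′≡0 = b≢0 (cong (ℤ._* P) b′≡0)
      ∣b′∣<∣b′*P∣ : ℤ.∣ b′ ∣ ℕ.< ℤ.∣ b′ ℤ.* P ∣
      ∣b′∣<∣b′*P∣ = subst (ℤ.∣ b′ ∣ ℕ.<_) (sym (ℤ.abs-* b′ P))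
        (ℕ.m<m*n ℤ.∣ b′ ∣ p {{ℕ.≢-nonZero (b′≢0 ∘ ℤ.∣i∣≡0⇒i≡0)}}
          (ℕ.≤-trans (ℕ.s≤s (ℕ.s≤s ℕ.z≤n)) 5≤p))
      scale : embed (ι P) *K (ι a′ +√ ι b′) ≡ ι (a′ ℤ.* P) +√ ι (b′ ℤ.* P)
      scale = trans (embed-*K (ι P) (ι a′ +√ ι b′))
        (cong₂ _+√_ (trans (ℚ.*-comm (ι P) (ι a′)) (sym (ι-* a′ P))) (trans (ℚ.*-comm (ι P) (ι b′)) (sym (ι-* b′ P))))

  im-^K≡0⇒im≡0 : ∀ (t : QF d) → im (t ^K p) ≡ 0ℚ → im t ≡ 0ℚ
  im-^K≡0⇒im≡0 t im-tᵖ≡0 = go (integral-multiple t)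
    where
    go : Σ[ c ∈ ℚ ] c ≢ 0ℚ × Σ[ i ∈ ℤ ] Σ[ j ∈ ℤ ] embed c *K t ≡ ι i +√ ι j → im t ≡ 0ℚ
    go (c , c≢0 , i , j , ct≡i+√j) = *-cancelˡ-≡0 c≢0 (trans (cong im (trans (sym (embed-*K c t)) ct≡i+√j)) (cong ι j≡0))
      where
      j≡0 : j ≡ 0ℤ
      j≡0 with j ℤ.≟ 0ℤ
      ... | yes j≡0 = j≡0
      ... | no j≢0  = contradiction (begin
        im ((ι i +√ ι j) ^K p)              ≡⟨ cong (λ u → im (u ^K p)) ct≡i+√j ⟨
        im ((embed c *K t) ^K p)            ≡⟨ im-[embed*K]^K c t p ⟩
        c ^ p ℚ.* im (t ^K p)               ≡⟨ cong (c ^ p ℚ.*_) im-tᵖ≡0 ⟩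
        c ^ p ℚ.* 0ℚ                        ≡⟨ ℚ.*-zeroʳ (c ^ p) ⟩
        0ℚ                                  ∎) (im-^K≢0 i j j≢0)
        where open ≡-Reasoning

-- From a solution in K to a primitive solution in ℤ

module RationalPoint {d : ℤ} (sqf : Squarefree d) (d≢1 : d ≢ 1ℤ) {p : ℕ} {A B C : ℤ}
                     (x y z : QF d) (sol : NontrivialSolK d p A B C x y z) where

  open import Algebra.Properties.RingWithoutOne (Ring.ringWithoutOne (CommutativeRing.ring (QF-commutativeRing d)))
    using ([y-z]x≈yx-zx)

  x≢0 : x ≢ 0K
  x≢0 x≡0 = proj₂ sol (trans (cong (λ w → (w *K y) *K z) x≡0) (trans (cong (_*K z) (*K-zeroˡ y)) (*K-zeroˡ z)))

  y≢0 : y ≢ 0K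
  y≢0 y≡0 = proj₂ sol (trans (cong (λ w → (x *K w) *K z) y≡0) (trans (cong (_*K z) (*K-zeroʳ x)) (*K-zeroˡ z)))

  z≢0 : z ≢ 0K
  z≢0 z≡0 = proj₂ sol (trans (cong ((x *K y) *K_) z≡0) (*K-zeroʳ (x *K y)))

  xᵖ≢0 : x ^K p ≢ 0K
  xᵖ≢0 = ^K-≢0K sqf d≢1 p x≢0

  v u : QF d
  v = y /K x
  u = z /K x

  private
    X = x ^K p
    Bvᵖ = ιK B *K (v ^K p)
    Cuᵖ = ιK C *K (u ^K p)

  ^K-via-quotient : ∀ w → w ^K p ≡ ((w /K x) ^K p) *K (x ^K p)
  ^K-via-quotient w = trans (cong (_^K p) (sym (/K*K-cancel sqf d≢1 w x≢0))) (^K-distrib-*K (w /K x) x p)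

  quotient-≢0K : ∀ {w} → w ≢ 0K → w /K x ≢ 0K
  quotient-≢0K {w} w≢0 w/x≡0 = w≢0 (trans (sym (/K*K-cancel sqf d≢1 w x≢0)) (trans (cong (_*K x) w/x≡0) (*K-zeroˡ x)))

  equation : ιK A +K ((ιK B *K (v ^K p)) +K (ιK C *K (u ^K p))) ≡ 0K
  equation = *K-cancelʳ sqf d≢1 xᵖ≢0 (begin
    (ιK A +K ((ιK B *K (v ^K p)) +K (ιK C *K (u ^K p)))) *K X
      ≡⟨ trans (*K-distribʳ-+K X (ιK A) (Bvᵖ +K Cuᵖ)) (cong ((ιK A *K X) +K_) (*K-distribʳ-+K X Bvᵖ Cuᵖ)) ⟩
    (ιK A *K X) +K (((ιK B *K (v ^K p)) *K X) +K ((ιK C *K (u ^K p)) *K X))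
      ≡⟨ cong₂ (λ s t → (ιK A *K X) +K (s +K t)) (*K-assoc (ιK B) (v ^K p) X) (*K-assoc (ιK C) (u ^K p) X) ⟩
    (ιK A *K X) +K ((ιK B *K ((v ^K p) *K X)) +K (ιK C *K ((u ^K p) *K X)))
      ≡⟨ cong₂ (λ s t → (ιK A *K X) +K ((ιK B *K s) +K (ιK C *K t))) (^K-via-quotient y) (^K-via-quotient z) ⟨
    (ιK A *K X) +K ((ιK B *K (y ^K p)) +K (ιK C *K (z ^K p)))
      ≡⟨ proj₁ sol ⟩
    0K
      ≡⟨ *K-zeroˡ X ⟨
    0K *K X ∎)
    where open ≡-Reasoning

  im-equation : ι B ℚ.* im (v ^K p) ℚ.+ ι C ℚ.* im (u ^K p) ≡ 0ℚ
  im-equation = begin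
    ι B ℚ.* im (v ^K p) ℚ.+ ι C ℚ.* im (u ^K p)           ≡⟨ ℚ.+-identityˡ _ ⟨
    0ℚ ℚ.+ (ι B ℚ.* im (v ^K p) ℚ.+ ι C ℚ.* im (u ^K p))  ≡⟨ cong₂ (λ s t → 0ℚ ℚ.+ (s ℚ.+ t))
                                                              (cong im (embed-*K (ι B) (v ^K p)))
                                                              (cong im (embed-*K (ι C) (u ^K p))) ⟨
    im (ιK A +K ((ιK B *K (v ^K p)) +K (ιK C *K (u ^K p))))  ≡⟨ cong im equation ⟩
    0ℚ                                                     ∎
    where open ≡-Reasoning

  difference-via-quotient : (ιK B *K (y ^K p)) -K (ιK C *K (z ^K p)) ≡ (Bvᵖ -K Cuᵖ) *K X
  difference-via-quotient = begin
    (ιK B *K (y ^K p)) -K (ιK C *K (z ^K p))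
      ≡⟨ cong₂ (λ s t → (ιK B *K s) -K (ιK C *K t)) (^K-via-quotient y) (^K-via-quotient z) ⟩
    (ιK B *K ((v ^K p) *K X)) -K (ιK C *K ((u ^K p) *K X))
      ≡⟨ cong₂ _-K_ (*K-assoc (ιK B) (v ^K p) X) (*K-assoc (ιK C) (u ^K p) X) ⟨
    (Bvᵖ *K X) -K (Cuᵖ *K X)
      ≡⟨ [y-z]x≈yx-zx X Bvᵖ Cuᵖ ⟨
    (Bvᵖ -K Cuᵖ) *K X ∎
    where open ≡-Reasoning

  Y-relation : B ≢ 0ℤ → C ≢ 0ℤ → InQ (assocY d p A B C x y z) →
               ι B ℚ.* im (v ^K p) ℚ.- ι C ℚ.* im (u ^K p) ≡ 0ℚ
  Y-relation B≢0 C≢0 Y∈ℚ = *-cancelˡ-≡0 (ι-≢0 k≢0) (begin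
    ι k ℚ.* (ι B ℚ.* im (v ^K p) ℚ.- ι C ℚ.* im (u ^K p))
      ≡⟨ cong (ι k ℚ.*_) (cong₂ ℚ._-_ (cong im (embed-*K (ι B) (v ^K p))) (cong im (embed-*K (ι C) (u ^K p)))) ⟨
    ι k ℚ.* im W                       ≡⟨ cong im (embed-*K (ι k) W) ⟨
    im (ιK k *K W)
      ≡⟨ cong im (*K-cancelʳ sqf d≢1 {ιK k *K W} {embed y₀ *K ιK (+ 2)} xᵖ≢0 kW*X≡y₀2*X) ⟩
    im (embed {d} y₀ *K ιK (+ 2))      ≡⟨ cong im (embed-*K-embed {d} y₀ (ι (+ 2))) ⟩
    0ℚ                                 ∎)
    where
    open ≡-Reasoning
    k = (ℤ.- (B ℤ.* C)) ℤ.^ ((p ℕ.∸ 1) ℕ./ 2)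
    k≢0 : k ≢ 0ℤ
    k≢0 k≡0 = [ B≢0 , C≢0 ]′ (ℤ.i*j≡0⇒i≡0∨j≡0 B
      (ℤ.neg-injective {B ℤ.* C} {0ℤ} (ℤ.i^n≡0⇒i≡0 (ℤ.- (B ℤ.* C)) ((p ℕ.∸ 1) ℕ./ 2) k≡0)))
    W = Bvᵖ -K Cuᵖ
    U = (ιK B *K (y ^K p)) -K (ιK C *K (z ^K p))
    D = ιK (+ 2) *K X
    D≢0 : D ≢ 0K
    D≢0 = *K-≢0K sqf d≢1 {ιK (+ 2)} (λ ()) xᵖ≢0
    y₀ = re (assocY d p A B C x y z)
    kW*X≡y₀2*X : (ιK k *K W) *K X ≡ (embed y₀ *K ιK (+ 2)) *K X
    kW*X≡y₀2*X = begin
      (ιK k *K W) *K X                 ≡⟨ *K-assoc (ιK k) W X ⟩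
      ιK k *K (W *K X)                 ≡⟨ cong (ιK k *K_) difference-via-quotient ⟨
      ιK k *K U                        ≡⟨ /K*K-cancel sqf d≢1 (ιK k *K U) D≢0 ⟨
      assocY d p A B C x y z *K D      ≡⟨ cong (_*K D) (cong (y₀ +√_) Y∈ℚ) ⟩
      embed y₀ *K D                    ≡⟨ *K-assoc (embed y₀) (ιK (+ 2)) X ⟨
      (embed y₀ *K ιK (+ 2)) *K X      ∎

  rational-solution : B ≢ 0ℤ → C ≢ 0ℤ → InQ (assocY d p A B C x y z) →
                      (∀ (t : QF d) → im (t ^K p) ≡ 0ℚ → im t ≡ 0ℚ) →
                      Σ[ τ ∈ ℚ ] Σ[ σ ∈ ℚ ] τ ≢ 0ℚ × σ ≢ 0ℚ ×
                        ι A ℚ.+ (ι B ℚ.* τ ^ p ℚ.+ ι C ℚ.* σ ^ p) ≡ 0ℚ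
  rational-solution B≢0 C≢0 Y∈ℚ pth-root =
    re v , re u , re-≢0 v≡re-v (quotient-≢0K y≢0) , re-≢0 u≡re-u (quotient-≢0K z≢0) , (begin
    ι A ℚ.+ (ι B ℚ.* re v ^ p ℚ.+ ι C ℚ.* re u ^ p)
      ≡⟨ cong₂ (λ s t → ι A ℚ.+ (re s ℚ.+ re t)) (rational-power B v≡re-v) (rational-power C u≡re-u) ⟨
    re (ιK A +K ((ιK B *K (v ^K p)) +K (ιK C *K (u ^K p))))
      ≡⟨ cong re equation ⟩
    0ℚ ∎)
    where
    open ≡-Reasoning
    im-vᵖ,uᵖ≡0 = x+y≡0∧x-y≡0⇒x≡0∧y≡0 im-equation (Y-relation B≢0 C≢0 Y∈ℚ)
    v≡re-v : v ≡ embed (re v)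
    v≡re-v = cong (re v +√_) (pth-root v (*-cancelˡ-≡0 (ι-≢0 B≢0) (proj₁ im-vᵖ,uᵖ≡0)))
    u≡re-u : u ≡ embed (re u)
    u≡re-u = cong (re u +√_) (pth-root u (*-cancelˡ-≡0 (ι-≢0 C≢0) (proj₂ im-vᵖ,uᵖ≡0)))
    re-≢0 : ∀ {w} → w ≡ embed (re w) → w ≢ 0K → re w ≢ 0ℚ
    re-≢0 w≡re-w w≢0 re-w≡0 = w≢0 (trans w≡re-w (cong embed re-w≡0))
    rational-power : ∀ c {w} → w ≡ embed (re w) → ιK c *K (w ^K p) ≡ embed (ι c ℚ.* re w ^ p)
    rational-power c {w} w≡re-w = trans (cong (λ t → ιK c *K (t ^K p)) w≡re-w)
      (trans (cong (ιK c *K_) (embed-^K (re w) p)) (embed-*K-embed (ι c) (re w ^ p)))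

module _ {n : ℕ} {A B C : ℤ} where

  IntegerSolution : ℤ → ℤ → ℤ → Set
  IntegerSolution X Y Z = A ℤ.* X ℤ.^ n ℤ.+ (B ℤ.* Y ℤ.^ n ℤ.+ C ℤ.* Z ℤ.^ n) ≡ 0ℤ

  clear-denominators : ∀ {y z} → y ≢ 0ℚ → z ≢ 0ℚ → ι A ℚ.+ (ι B ℚ.* y ^ n ℚ.+ ι C ℚ.* z ^ n) ≡ 0ℚ →
                       Σ[ X ∈ ℤ ] Σ[ Y ∈ ℤ ] Σ[ Z ∈ ℤ ] X ≢ 0ℤ × Y ≢ 0ℤ × Z ≢ 0ℤ × IntegerSolution X Y Z
  clear-denominators {y} {z} y≢0 z≢0 eq = D , ↥ y ℤ.* ↧ z , ↥ z ℤ.* ↧ y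
    , *-≢0ℤ (↧≢0 y) (↧≢0 z) , *-≢0ℤ (↥≢0 y≢0) (↧≢0 z) , *-≢0ℤ (↥≢0 z≢0) (↧≢0 y)
    , ι-injective (begin
      ι (A ℤ.* D ℤ.^ n ℤ.+ (B ℤ.* (↥ y ℤ.* ↧ z) ℤ.^ n ℤ.+ C ℤ.* (↥ z ℤ.* ↧ y) ℤ.^ n))
        ≡⟨ ι-linear ⟩
      ι A ℚ.* ι D ^ n ℚ.+ (ι B ℚ.* ι (↥ y ℤ.* ↧ z) ^ n ℚ.+ ι C ℚ.* ι (↥ z ℤ.* ↧ y) ^ n)
        ≡⟨ cong₂ (λ s t → ι A ℚ.* ι D ^ n ℚ.+ (ι B ℚ.* s ^ n ℚ.+ ι C ℚ.* t ^ n)) ιY≡y*ιD ιZ≡z*ιD ⟩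
      ι A ℚ.* ι D ^ n ℚ.+ (ι B ℚ.* (y ℚ.* ι D) ^ n ℚ.+ ι C ℚ.* (z ℚ.* ι D) ^ n)
        ≡⟨ cong₂ (λ s t → ι A ℚ.* ι D ^ n ℚ.+ (ι B ℚ.* s ℚ.+ ι C ℚ.* t))
                 (^-distrib-* y (ι D) n) (^-distrib-* z (ι D) n) ⟩
      ι A ℚ.* ι D ^ n ℚ.+ (ι B ℚ.* (y ^ n ℚ.* ι D ^ n) ℚ.+ ι C ℚ.* (z ^ n ℚ.* ι D ^ n))
        ≡⟨ factor (ι A) (ι B) (ι C) (y ^ n) (z ^ n) (ι D ^ n) ⟩
      (ι A ℚ.+ (ι B ℚ.* y ^ n ℚ.+ ι C ℚ.* z ^ n)) ℚ.* ι D ^ n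
        ≡⟨ cong (ℚ._* ι D ^ n) eq ⟩
      0ℚ ℚ.* ι D ^ n
        ≡⟨ ℚ.*-zeroˡ (ι D ^ n) ⟩
      0ℚ ∎)
    where
    open ≡-Reasoning
    D = ↧ y ℤ.* ↧ z
    ιY≡y*ιD : ι (↥ y ℤ.* ↧ z) ≡ y ℚ.* ι D
    ιY≡y*ιD = sym (q*ι[↧q*n]≡ι[↥q*n] y (↧ z))
    ιZ≡z*ιD : ι (↥ z ℤ.* ↧ y) ≡ z ℚ.* ι D
    ιZ≡z*ιD = trans (sym (q*ι[↧q*n]≡ι[↥q*n] z (↧ y))) (cong (λ e → z ℚ.* ι e) (ℤ.*-comm (↧ z) (↧ y)))
    factor : ∀ a b c Y Z E → a ℚ.* E ℚ.+ (b ℚ.* (Y ℚ.* E) ℚ.+ c ℚ.* (Z ℚ.* E))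
                           ≡ (a ℚ.+ (b ℚ.* Y ℚ.+ c ℚ.* Z)) ℚ.* E
    factor = solve-∀ ℚ-ring
    ι-linear : ∀ {X Y Z} → ι (A ℤ.* X ℤ.^ n ℤ.+ (B ℤ.* Y ℤ.^ n ℤ.+ C ℤ.* Z ℤ.^ n))
                           ≡ ι A ℚ.* ι X ^ n ℚ.+ (ι B ℚ.* ι Y ^ n ℚ.+ ι C ℚ.* ι Z ^ n)
    ι-linear {X} {Y} {Z} = trans (ι-+ (A ℤ.* X ℤ.^ n) _)
      (cong₂ ℚ._+_ (ι-*^ A X) (trans (ι-+ (B ℤ.* Y ℤ.^ n) _) (cong₂ ℚ._+_ (ι-*^ B Y) (ι-*^ C Z))))
      where
      ι-*^ : ∀ c w → ι (c ℤ.* w ℤ.^ n) ≡ ι c ℚ.* ι w ^ n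
      ι-*^ c w = trans (ι-* c (w ℤ.^ n)) (cong (ι c ℚ.*_) (ι-^ w n))

  IntegerSolution-cancel : ∀ {q X Y Z} → Prime q → IntegerSolution (X ℤ.* + q) (Y ℤ.* + q) (Z ℤ.* + q) → IntegerSolution X Y Z
  IntegerSolution-cancel {q} {X} {Y} {Z} q-prime sol =
    [ (λ qⁿ≡0 → contradiction qⁿ≡0 (pᵏ≢0 q-prime n)) , id ]′
      (ℤ.i*j≡0⇒i≡0∨j≡0 ((+ q) ℤ.^ n) (trans factored sol))
    where
    factor : ∀ a b c x y z e → e ℤ.* (a ℤ.* x ℤ.+ (b ℤ.* y ℤ.+ c ℤ.* z))
                             ≡ a ℤ.* (x ℤ.* e) ℤ.+ (b ℤ.* (y ℤ.* e) ℤ.+ c ℤ.* (z ℤ.* e))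
    factor = solve-∀ℤ
    factored : (+ q) ℤ.^ n ℤ.* (A ℤ.* X ℤ.^ n ℤ.+ (B ℤ.* Y ℤ.^ n ℤ.+ C ℤ.* Z ℤ.^ n))
               ≡ A ℤ.* (X ℤ.* + q) ℤ.^ n ℤ.+ (B ℤ.* (Y ℤ.* + q) ℤ.^ n ℤ.+ C ℤ.* (Z ℤ.* + q) ℤ.^ n)
    factored = trans (factor A B C (X ℤ.^ n) (Y ℤ.^ n) (Z ℤ.^ n) ((+ q) ℤ.^ n))
      (sym (cong₂ (λ s t → A ℤ.* s ℤ.+ t) (^-distribʳ-* X (+ q) n)
             (cong₂ (λ s t → B ℤ.* s ℤ.+ C ℤ.* t) (^-distribʳ-* Y (+ q) n) (^-distribʳ-* Z (+ q) n))))

prime∣third : ∀ {n a b c X Y Z q} → Prime q → PthPowerFree n c → + q ℤ∣.∣ X → + q ℤ∣.∣ Y →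
              IntegerSolution {n} {a} {b} {c} X Y Z → + q ℤ∣.∣ Z
prime∣third {n} {a} {b} {c} {X} {Y} {Z} {q} q-prime c-free q∣X q∣Y sol = prime∣i q-prime {n} {c} {Z} c-free
  (subst ((+ q) ℤ.^ n ℤ∣.∣_) (sym (u≡-[s+t] {a ℤ.* X ℤ.^ n} {b ℤ.* Y ℤ.^ n} sol))
    (ℤ∣.∣m⇒∣-m (ℤ∣.∣m∣n⇒∣m+n (ℤ∣.∣n⇒∣m*n a (^-pres-∣ n q∣X)) (ℤ∣.∣n⇒∣m*n b (^-pres-∣ n q∣Y)))))
  where
  rearrange : ∀ s t u → u ≡ s ℤ.+ (t ℤ.+ u) ℤ.+ ℤ.- (s ℤ.+ t)
  rearrange = solve-∀ℤ
  u≡-[s+t] : ∀ {s t u} → s ℤ.+ (t ℤ.+ u) ≡ 0ℤ → u ≡ ℤ.- (s ℤ.+ t)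
  u≡-[s+t] {s} {t} {u} s+t+u≡0 = trans (rearrange s t u) (trans (cong (ℤ._+ ℤ.- (s ℤ.+ t)) s+t+u≡0) (ℤ.+-identityˡ _))

module _ {n : ℕ} {A B C : ℤ} (A-free : PthPowerFree n A) (B-free : PthPowerFree n B) (C-free : PthPowerFree n C) where

  private
    Solution = IntegerSolution {n} {A} {B} {C}

  common-prime : ∀ {X Y Z} → X ≢ 0ℤ → Y ≢ 0ℤ → Solution X Y Z →
                 ¬ (ℤC.Coprime X Y × ℤC.Coprime Y Z × ℤC.Coprime X Z) →
                 Σ[ q ∈ ℕ ] Prime q × + q ℤ∣.∣ X × + q ℤ∣.∣ Y × + q ℤ∣.∣ Z
  common-prime {X} {Y} {Z} X≢0 Y≢0 sol ¬coprime with ℤC.coprime? X Y | ℤC.coprime? Y Z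
  ... | no ¬X⊥Y | _ =
    let q , q-prime , q∣X , q∣Y = ¬coprime⇒common-prime X≢0 ¬X⊥Y
    in  q , q-prime , q∣X , q∣Y , prime∣third {n} {A} {B} {C} q-prime C-free q∣X q∣Y sol
  ... | yes _ | no ¬Y⊥Z =
    let q , q-prime , q∣Y , q∣Z = ¬coprime⇒common-prime Y≢0 ¬Y⊥Z
    in  q , q-prime , prime∣third {n} {B} {C} {A} q-prime A-free q∣Y q∣Z
                        (trans (rotate (A ℤ.* X ℤ.^ n) (B ℤ.* Y ℤ.^ n) (C ℤ.* Z ℤ.^ n)) sol)
                    , q∣Y , q∣Z
    where
    rotate : ∀ s t u → t ℤ.+ (u ℤ.+ s) ≡ s ℤ.+ (t ℤ.+ u)
    rotate = solve-∀ℤ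
  ... | yes X⊥Y | yes Y⊥Z =
    let q , q-prime , q∣X , q∣Z = ¬coprime⇒common-prime X≢0 (λ X⊥Z → ¬coprime (X⊥Y , Y⊥Z , X⊥Z))
    in  q , q-prime , q∣X
        , prime∣third {n} {A} {C} {B} q-prime B-free q∣X q∣Z
            (trans (swap (A ℤ.* X ℤ.^ n) (B ℤ.* Y ℤ.^ n) (C ℤ.* Z ℤ.^ n)) sol)
        , q∣Z
    where
    swap : ∀ s t u → s ℤ.+ (u ℤ.+ t) ≡ s ℤ.+ (t ℤ.+ u)
    swap = solve-∀ℤ

  primitive-solution : ∀ {X Y Z} → X ≢ 0ℤ → Y ≢ 0ℤ → Z ≢ 0ℤ → Solution X Y Z → HasPrimitiveSolZ n A B C
  primitive-solution {X} = go (<-wellFounded ℤ.∣ X ∣)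
    where
    go : ∀ {X Y Z} → Acc ℕ._<_ ℤ.∣ X ∣ → X ≢ 0ℤ → Y ≢ 0ℤ → Z ≢ 0ℤ → Solution X Y Z → HasPrimitiveSolZ n A B C
    go {X} {Y} {Z} (acc rec) X≢0 Y≢0 Z≢0 sol with ℤC.coprime? X Y ×-dec ℤC.coprime? Y Z ×-dec ℤC.coprime? X Z
    ... | yes (X⊥Y , Y⊥Z , X⊥Z) = X , Y , Z , sol , *-≢0ℤ (*-≢0ℤ X≢0 Y≢0) Z≢0 , X⊥Y , Y⊥Z , X⊥Z
    ... | no ¬coprime with common-prime {X} {Y} {Z} X≢0 Y≢0 sol ¬coprime
    ...   | q , q-prime , divides X′ refl , divides Y′ refl , divides Z′ refl =
      go {X′} {Y′} {Z′} (rec ∣X′∣<∣X′*q∣)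
        (X≢0 ∘ cong (ℤ._* + q)) (Y≢0 ∘ cong (ℤ._* + q)) (Z≢0 ∘ cong (ℤ._* + q))
        (IntegerSolution-cancel {n} {A} {B} {C} {q} {X′} {Y′} {Z′} q-prime sol)
      where
      instance _ = prime⇒nonTrivial q-prime
      ∣X′∣<∣X′*q∣ : ℤ.∣ X′ ∣ ℕ.< ℤ.∣ X′ ℤ.* + q ∣
      ∣X′∣<∣X′*q∣ = subst (ℤ.∣ X′ ∣ ℕ.<_) (sym (ℤ.abs-* X′ (+ q)))
        (ℕ.m<m*n ℤ.∣ X′ ∣ q {{ℕ.≢-nonZero (X≢0 ∘ cong (ℤ._* + q) ∘ ℤ.∣i∣≡0⇒i≡0 {X′})}}
          (ℕ.nonTrivial⇒n>1 q))

proposition4p8 : (d : ℤ) → Squarefree d → d ≢ 0ℤ → d ≢ 1ℤ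
    → (p : ℕ) → Prime p → p > 3
    → (A B C : ℤ) → Coprime A B → Coprime B C → Coprime A C
    → PthPowerFree p A → PthPowerFree p B → PthPowerFree p C
    → (x y z : QF d) → NontrivialSolK d p A B C x y z
    → InQ (assocY d p A B C x y z)
    → HasPrimitiveSolZ p A B C
proposition4p8 d sqf _ d≢1 p p-prime 3<p A B C _ _ _ A-free B-free C-free x y z sol Y∈ℚ
  with prime>3⇒odd p-prime 3<p
... | m , refl , 2≤m =
  let τ , σ , τ≢0 , σ≢0 , rational-sol = RationalPoint.rational-solution sqf d≢1 {p} {A} {B} {C} x y z sol
        (PthPowerFree⇒≢0 {p} B-free) (PthPowerFree⇒≢0 {p} C-free) Y∈ℚ
        (im-^K≡0⇒im≡0 p-prime 2≤m (squarefree⇒p²∤d sqf p-prime))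
      X , Y , Z , X≢0 , Y≢0 , Z≢0 , integer-sol = clear-denominators {p} {A} {B} {C} τ≢0 σ≢0 rational-sol
  in  primitive-solution {p} {A} {B} {C} A-free B-free C-free {X} {Y} {Z} X≢0 Y≢0 Z≢0 integer-sol
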